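{- Let $R$ be a nonempty word over $\{\bullet,\circ\}$ and $S$ any word over $\{\bullet,\circ\}$. Then \[ \tau_{R,S}=\sum_{k\ge1}(\zeta_{1,k}+\zeta_{2,k}), \] where \[ \zeta_{1,k}=\sum_{(\eta_1,\ldots,\eta_k)\in\mathcal C_k(R)} w^{\iota(\eta_1,\ldots,\eta_k)}\,g_{\bullet\eta_k}\,\Omega(\eta)\,\phi_{\eta_{k,1}\cdots\eta_{1,1}S},\qquad \zeta_{2,k}=\sum_{(\eta_1,\ldots,\eta_k)\in\mathcal C_k(R)} w^{\iota(\eta_1,\ldots,\eta_k)+1}\,g_{\bullet}\,f_{(\bullet\eta_k)}\,\Omega(\eta)\,\phi_{\bullet\eta_{k,1}\cdots\eta_{1,1}S}, \] and $\Omega(\eta)=\prod_{1\le j\le k-1}f_{(\eta_j\eta_{j+1,1})}$. Furthermore $\tau_{\epsilon,S}=g_\bullet\phi_{\bullet S}$.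
   Context: Words are finite strings over $\{\bullet,\circ\}$; $\epsilon$ is the empty word, $\ell(R)$ the length, $R_i$ the $i$-th symbol. For a word $S$, $(S)$ denotes the multiset of its cyclic shifts (a cyclic binary string). There are indeterminates $g_S$ (words $S$), $f_{(S)}$ (cyclic binary strings), $v$, $w$; series are formal power series in $v$ with polynomial coefficients in the other indeterminates. Define \[ C''=\sum_{R}\Big(\sum_{2\le i\le\ell(R)} w^{\delta_{R_i,\bullet}}g_{R_1R_i\cdots R_{\ell(R)}}f_{(R_2\cdots R_i)}+w\,g_{R_1}f_{(R)}\Big)\frac{\partial}{\partial g_R} \] ($R$ over nonempty words, $\delta$ the Kronecker delta). For $i\ge1$ let $\phi(v,x_1,\dots,x_i)=\sum_{n\ge i}h_{n-i}(x_1,\dots,x_i)\frac{v^n}{n!}$ with $h_j$ the complete homogeneous symmetric polynomial, and $\phi(v)=1$. For a word $S=S_1\cdots S_i$, $\phi_S=\phi_S(v)$ is $\phi(v,x_1,\dots,x_i)$ evaluated at $x_j=f_{(\circ)}$ if $S_j=\circ$ and $x_j=wf_{(\bullet)}$ if $S_j=\bullet$ (so $\phi_\epsilon=1$). For words $R,S$, $\tau_{R,S}$ is the unique solution of $\big(\frac{\partial}{\partial v}-C''\big)\tau_{R,S}=g_{\bullet R}\,\phi_S(v)$ with $\tau_{R,S}|_{v=0}=0$. A string composition of $R$ into $k$ parts is a sequence $(\eta_1,\dots,\eta_k)$ of nonempty words with $\eta_1\cdots\eta_k=R$; $\mathcal C_k(R)$ is the set of these; $\eta_{j,1}$ is the first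 symbol of $\eta_j$; and $\iota(\eta_1,\dots,\eta_k)=|\{2\le j\le k:\eta_{j,1}=\bullet\}|$. -}

module Defs where

open import Data.Bool using (Bool; true; false; _∧_; _∨_; if_then_else_)
open import Data.Nat as ℕ using (ℕ; zero; suc; _∸_; _!)
open import Data.Nat.Properties using (_!≢0)
open import Data.Integer using (+_)
open import Data.Rational as ℚ using (ℚ; 0ℚ; 1ℚ; _/_)
open import Data.List using (List; []; _∷_; _++_; map; concatMap; foldr; length; reverse; take; drop; upTo)
open import Data.Bool.ListAction using (all; any)
open import Data.Product using (_×_; _,_; proj₁; proj₂)
open import Relation.Binary.PropositionalEquality using (_≡_)

data Sym : Set where
  ● ○ : Sym

Word : Set
Word = List Sym

symEq : Sym → Sym → Bool
symEq ● ● = true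
symEq ○ ○ = true
symEq _ _ = false

wordEq : Word → Word → Bool
wordEq [] [] = true
wordEq (x ∷ xs) (y ∷ ys) = symEq x y ∧ wordEq xs ys
wordEq _ _ = false

rotations : Word → List Word
rotations S = map (λ k → drop k S ++ take k S) (upTo (length S))

cycEq : Word → Word → Bool
cycEq [] [] = true
cycEq S T = any (wordEq T) (rotations S)

-- Indeterminates: g_S (S a word), f_(S) (cyclic string, represented by a
-- word, identified up to rotation), and w.  (v is the series variable.)

data Var : Set where
  g : Word → Var
  f : Word → Var
  w : Var

varEq : Var → Var → Bool
varEq (g S) (g T) = wordEq S T
varEq (f S) (f T) = cycEq S T
varEq w w = true
varEq _ _ = false

-- Polynomials over ℚ in the indeterminates Var.
-- A monomial is a finite list of variables (a multiset); a polynomial is a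
-- finite list of (coefficient, monomial); equality is coefficientwise.

Mon : Set
Mon = List Var

Poly : Set
Poly = List (ℚ × Mon)

countVar : Var → Mon → ℕ
countVar x [] = 0
countVar x (y ∷ m) = if varEq x y then suc (countVar x m) else countVar x m

sameMon : Mon → Mon → Bool
sameMon m n = all (λ x → countVar x m ℕ.≡ᵇ countVar x n) (m ++ n)

sumℚ : List ℚ → ℚ
sumℚ = foldr ℚ._+_ 0ℚ

coeff : Poly → Mon → ℚ
coeff p m = sumℚ (map (λ t → if sameMon (proj₂ t) m then proj₁ t else 0ℚ) p)

infix 4 _≈P_
_≈P_ : Poly → Poly → Set
p ≈P q = ∀ (m : Mon) → coeff p m ≡ coeff q m

0P 1P : Poly
0P = []
1P = (1ℚ , []) ∷ []

var : Var → Poly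
var x = (1ℚ , x ∷ []) ∷ []

infixl 6 _+P_
infixl 7 _*P_
_+P_ : Poly → Poly → Poly
p +P q = p ++ q

_*P_ : Poly → Poly → Poly
p *P q = concatMap (λ s → map (λ t → (proj₁ s ℚ.* proj₁ t , proj₂ s ++ proj₂ t)) q) p

scale : ℚ → Poly → Poly
scale c p = map (λ t → (c ℚ.* proj₁ t , proj₂ t)) p

sumP : List Poly → Poly
sumP = foldr _+P_ 0P

prodP : List Poly → Poly
prodP = foldr _*P_ 1P

wpow : ℕ → Poly
wpow zero = 1P
wpow (suc n) = var w *P wpow n

wδ : Sym → Poly
wδ ● = var w
wδ ○ = 1P

picks : Word → List (Word × Sym × Word)
picks [] = []
picks (x ∷ xs) = ([] , x , xs) ∷ map (λ t → (x ∷ proj₁ t , proj₂ t)) (picks xs)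

-- C''(g_R) for R = r ∷ rest nonempty:
--  sum_{2≤i≤ℓ(R)} w^{δ(R_i,•)} g_{R_1 R_i ⋯ R_ℓ} f_{(R_2 ⋯ R_i)}  +  w g_{R_1} f_{(R)}
-- (a term with rest = a ++ (x ∷ b) corresponds to R_i = x.)
Cg : Sym → Word → Poly
Cg r rest =
  sumP (map (λ t → let a = proj₁ t ; x = proj₁ (proj₂ t) ; b = proj₂ (proj₂ t)
                   in wδ x *P var (g (r ∷ x ∷ b)) *P var (f (a ++ x ∷ [])))
            (picks rest))
  +P (var w *P var (g (r ∷ [])) *P var (f (r ∷ rest)))

dVar : Var → Poly
dVar (g (r ∷ rest)) = Cg r rest
dVar _ = 0P

dMon : Mon → Poly
dMon [] = 0P
dMon (x ∷ m) = (dVar x *P ((1ℚ , m) ∷ [])) +P (((1ℚ , x ∷ []) ∷ []) *P dMon m)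

C'' : Poly → Poly
C'' p = sumP (map (λ t → scale (proj₁ t) (dMon (proj₂ t))) p)

-- Formal power series in v with polynomial coefficients:
-- a series is its coefficient sequence (coefficient of v^n).

Series : Set
Series = ℕ → Poly

infix 4 _≈S_
_≈S_ : Series → Series → Set
A ≈S B = ∀ (n : ℕ) → A n ≈P B n

-- complete homogeneous symmetric polynomial h_j(x_1,…,x_i)
h : ℕ → List Poly → Poly
h zero [] = 1P
h (suc j) [] = 0P
h j (x ∷ xs) = sumP (map (λ a → prodP (map (λ _ → x) (upTo a)) *P h (j ∸ a) xs) (upTo (suc j)))

invFact : ℕ → ℚ
invFact n = (+ 1 / (n !)) {{n !≢0}}

-- φ(v, x_1,…,x_i) = Σ_{n≥i} h_{n-i}(x) v^n / n!  (i ≥ 1),  φ(v) = 1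
φ : List Poly → Series
φ [] zero = 1P
φ [] (suc n) = 0P
φ xs@(_ ∷ _) n = if length xs ℕ.≤ᵇ n then scale (invFact n) (h (n ∸ length xs) xs) else 0P

symVal : Sym → Poly
symVal ○ = var (f (○ ∷ []))
symVal ● = var w *P var (f (● ∷ []))

φW : Word → Series
φW S = φ (map symVal S)

-- τ_{R,S}: the unique solution of (∂/∂v − C'') τ = g_{•R} φ_S, τ|_{v=0} = 0,
-- i.e. τ_0 = 0 and (n+1) τ_{n+1} = C''(τ_n) + g_{•R} (φ_S)_n.
τ : Word → Word → Series
τ R S zero = 0P
τ R S (suc n) = scale ((+ 1 / suc n)) (C'' (τ R S n) +P (var (g (● ∷ R)) *P φW S n))

-- String compositions. A part is a nonempty word, represented as
-- (first symbol , rest).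

Part : Set
Part = Sym × Word

pw : Part → Word
pw (x , xs) = x ∷ xs

nsplits : Word → List (Part × Word)
nsplits [] = []
nsplits (x ∷ xs) = ((x , []) , xs) ∷ map (λ t → ((x , pw (proj₁ t)) , proj₂ t)) (nsplits xs)

comps : ℕ → Word → List (List Part)
comps zero [] = [] ∷ []
comps zero (_ ∷ _) = []
comps (suc k) R = concatMap (λ t → map (proj₁ t ∷_) (comps k (proj₂ t))) (nsplits R)

count● : List Part → ℕ
count● [] = 0
count● ((● , _) ∷ ps) = suc (count● ps)
count● ((○ , _) ∷ ps) = count● ps

ι : List Part → ℕ
ι [] = 0
ι (_ ∷ rest) = count● rest

Ω : List Part → Poly
Ω (p ∷ q ∷ rest) = var (f (pw p ++ proj₁ q ∷ [])) *P Ω (q ∷ rest)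
Ω _ = 1P

-- the last part η_k (compositions in 𝒞_k with k ≥ 1 are nonempty lists;
-- the [] case is never used)
lastW : List Part → Word
lastW [] = []
lastW (p ∷ []) = pw p
lastW (_ ∷ q ∷ rest) = lastW (q ∷ rest)

firsts : List Part → Word
firsts η = reverse (map proj₁ η)

ζ₁ : ℕ → Word → Word → Series
ζ₁ k R S n = sumP (map (λ η → wpow (ι η) *P var (g (● ∷ lastW η)) *P Ω η
                                 *P φW (firsts η ++ S) n) (comps k R))

ζ₂ : ℕ → Word → Word → Series
ζ₂ k R S n = sumP (map (λ η → wpow (suc (ι η)) *P var (g (● ∷ [])) *P var (f (● ∷ lastW η))
                                 *P Ω η *P φW (● ∷ firsts η ++ S) n) (comps k R))

-- Σ_{k≥1} (ζ_{1,k} + ζ_{2,k}); 𝒞_k(R) = ∅ for k > ℓ(R), so k ranges over 1..ℓ(R)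
ζsum : Word → Word → Series
ζsum R S n = sumP (map (λ j → ζ₁ (suc j) R S n +P ζ₂ (suc j) R S n) (upTo (length R)))

τε : Word → Series
τε S n = var (g (● ∷ [])) *P φW (● ∷ S) n

-- Both τ_{R,S} and ζ = Σ_k (ζ_{1,k} + ζ_{2,k}) are determined by their
-- coefficients, and τ by τ₀ = 0 and (n+1) τ_{n+1} = C''(τ_n) + g_{•R} (φ_S)_n,
-- so it suffices that ζ obeys the same recursion. C'' is a derivation that
-- kills w and every f, hence Ω and φ, while ∂_v φ_{xF} = φ_F + x φ_{xF}.
-- Differentiating the summand of a composition η therefore produces a term in
-- which the first letter of the φ-index is dropped, plus exactly those terms of
-- C'' of the summand in which g_{•η_k} is cut at its first letter or closed
-- off; the remaining terms of C'' cut η_k = a x b in its interior. Such a cut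
-- of a k-part composition is the drop term of the (k+1)-part composition
-- (…, a, x b), so the drop terms of all compositions equal the interior cuts
-- plus the drop term g_{•R} φ_S of the one-part composition R.
--
-- Polynomials are compared coefficientwise up to reordering of monomials,
-- which gives a commutative ring where the ring solver applies and which
-- refines ≈P.

module Submission where

open import Defs
open import Data.Bool using (Bool; true; false; if_then_else_; _∧_)
import Data.Bool.Properties as Boolₚ
open import Data.Bool.ListAction using (all)
open import Data.Nat as ℕ using (ℕ; zero; suc; _∸_; _!; NonZero; _≤ᵇ_)
open import Data.Nat.Properties using (_!≢0)
import Data.Nat.Properties as ℕₚ
open import Data.Integer as ℤ using (+_)
import Data.Integer.Properties as ℤₚ
import Data.Integer.GCD as ℤ
open import Data.Rational as ℚ using (ℚ; 0ℚ; 1ℚ; _/_; ↥_; ↧_; ↧ₙ_)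
import Data.Rational.Properties as ℚₚ
open import Data.Rational.Solver using (module +-*-Solver)
open import Data.List using (List; []; _∷_; _++_; [_]; map; concatMap; length; reverse; upTo; applyUpTo; filter)
import Data.List.Properties as List
open import Data.List.Relation.Unary.All as All using (All; []; _∷_)
import Data.List.Relation.Unary.All.Properties as All
open import Data.List.Relation.Unary.Any using (here)
open import Data.List.Membership.Propositional.Properties using (∈-∃++)
open import Data.List.Relation.Binary.Permutation.Propositional as Perm
  using (_↭_; prep; swap; ↭-refl; ↭-sym; ↭-trans)
import Data.List.Relation.Binary.Permutation.Propositional.Properties as ↭
open import Data.Product using (_×_; _,_; proj₁; proj₂)
open import Data.Empty using (⊥-elim)
open import Data.Sum using (inj₁; inj₂)
open import Function using (_∘_; id)
open import Function.Bundles using (Equivalence)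
open import Relation.Nullary using (Dec; yes; no; ¬_; ¬?)
open import Relation.Binary.Definitions using (DecidableEquality; Decidable)
open import Relation.Binary.Core using (_Preserves_⟶_)
open import Algebra.Bundles using (CommutativeRing)
open import Level using (0ℓ)
open import Relation.Binary.PropositionalEquality
  using (_≡_; refl; sym; trans; cong; cong₂; subst; module ≡-Reasoning)

private variable
  A B : Set

_≟Sym_ : DecidableEquality Sym
● ≟Sym ● = yes refl
● ≟Sym ○ = no λ ()
○ ≟Sym ● = no λ ()
○ ≟Sym ○ = yes refl

_≟Var_ : DecidableEquality Var
g S ≟Var g T with List.≡-dec _≟Sym_ S T
... | yes refl = yes refl
... | no S≢T = no λ { refl → S≢T refl }
f S ≟Var f T with List.≡-dec _≟Sym_ S T
... | yes refl = yes refl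
... | no S≢T = no λ { refl → S≢T refl }
w ≟Var w = yes refl
g _ ≟Var f _ = no λ ()
g _ ≟Var w = no λ ()
f _ ≟Var g _ = no λ ()
f _ ≟Var w = no λ ()
w ≟Var g _ = no λ ()
w ≟Var f _ = no λ ()

open import Data.List.Membership.DecPropositional _≟Var_ using (_∈?_)

_↭?_ : Decidable (_↭_ {A = Var})
[] ↭? [] = yes ↭-refl
[] ↭? (y ∷ b) = no (↭.¬x∷xs↭[] ∘ ↭-sym)
(x ∷ a) ↭? b with x ∈? b
... | no x∉b = no λ xa↭b → x∉b (↭.∈-resp-↭ xa↭b (here refl))
... | yes x∈b with ∈-∃++ x∈b
...   | bs , cs , refl with a ↭? (bs ++ cs)
...     | yes a↭ = yes (↭-trans (prep x a↭) (↭-sym (↭.shift x bs cs)))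
...     | no ¬a↭ = no λ xa↭ → ¬a↭ (↭.drop-mid [] bs xa↭)

open +-*-Solver using (solve; _:+_; _:*_; _:=_; con)

lin : (Mon → ℚ) → Poly → ℚ
lin G [] = 0ℚ
lin G ((c , a) ∷ p) = c ℚ.* G a ℚ.+ lin G p

χ : Mon → Mon → ℚ
χ a m with a ↭? m
... | yes _ = 1ℚ
... | no _ = 0ℚ

coeff↭ : Poly → Mon → ℚ
coeff↭ p m = lin (λ a → χ a m) p

infix 4 _≅_
record _≅_ (p q : Poly) : Set where
  constructor coeff↭-≅
  field coeff↭-≡ : ∀ m → coeff↭ p m ≡ coeff↭ q m
open _≅_ public

χ-resp-↭ : ∀ m → (λ a → χ a m) Preserves _↭_ ⟶ _≡_
χ-resp-↭ m {a} {b} a↭b with a ↭? m | b ↭? m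
... | yes _ | yes _ = refl
... | no _ | no _ = refl
... | yes a↭m | no ¬b↭m = ⊥-elim (¬b↭m (↭-trans (↭-sym a↭b) a↭m))
... | no ¬a↭m | yes b↭m = ⊥-elim (¬a↭m (↭-trans a↭b b↭m))

χ≡1 : ∀ {a m} → a ↭ m → χ a m ≡ 1ℚ
χ≡1 {a} {m} a↭m with a ↭? m
... | yes _ = refl
... | no ¬a↭m = ⊥-elim (¬a↭m a↭m)

lin-++ : ∀ G p q → lin G (p ++ q) ≡ lin G p ℚ.+ lin G q
lin-++ G [] q = sym (ℚₚ.+-identityˡ _)
lin-++ G ((c , a) ∷ p) q =
  trans (cong (c ℚ.* G a ℚ.+_) (lin-++ G p q)) (sym (ℚₚ.+-assoc (c ℚ.* G a) (lin G p) (lin G q)))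

lin-cong : ∀ {F G} p → (∀ a → F a ≡ G a) → lin F p ≡ lin G p
lin-cong [] F≗G = refl
lin-cong ((c , a) ∷ p) F≗G = cong₂ (λ x y → c ℚ.* x ℚ.+ y) (F≗G a) (lin-cong p F≗G)

lin-zero : ∀ p → lin (λ _ → 0ℚ) p ≡ 0ℚ
lin-zero [] = refl
lin-zero ((c , a) ∷ p) = cong₂ ℚ._+_ (ℚₚ.*-zeroʳ c) (lin-zero p)

lin-+ : ∀ F G p → lin (λ a → F a ℚ.+ G a) p ≡ lin F p ℚ.+ lin G p
lin-+ F G [] = refl
lin-+ F G ((c , a) ∷ p) = trans (cong (c ℚ.* (F a ℚ.+ G a) ℚ.+_) (lin-+ F G p))
  (solve 5 (λ c x y l k → c :* (x :+ y) :+ (l :+ k) := (c :* x :+ l) :+ (c :* y :+ k)) refl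
     c (F a) (G a) (lin F p) (lin G p))

lin-*ˡ : ∀ k G p → lin (λ a → k ℚ.* G a) p ≡ k ℚ.* lin G p
lin-*ˡ k G [] = sym (ℚₚ.*-zeroʳ k)
lin-*ˡ k G ((c , a) ∷ p) = trans (cong (c ℚ.* (k ℚ.* G a) ℚ.+_) (lin-*ˡ k G p))
  (solve 4 (λ k c x l → c :* (k :* x) :+ k :* l := k :* (c :* x :+ l)) refl k c (G a) (lin G p))

lin-scale : ∀ k G p → lin G (scale k p) ≡ k ℚ.* lin G p
lin-scale k G [] = sym (ℚₚ.*-zeroʳ k)
lin-scale k G ((c , a) ∷ p) = trans (cong ((k ℚ.* c) ℚ.* G a ℚ.+_) (lin-scale k G p))
  (solve 4 (λ k c x l → (k :* c) :* x :+ k :* l := k :* (c :* x :+ l)) refl k c (G a) (lin G p))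

lin-*P : ∀ G p q → lin G (p *P q) ≡ lin (λ a → lin (λ b → G (a ++ b)) q) p
lin-*P G [] q = refl
lin-*P G ((c , a) ∷ p) q =
  trans (lin-++ G (map (λ t → (c ℚ.* proj₁ t , a ++ proj₂ t)) q) (p *P q)) (cong₂ ℚ._+_ (leading q) (lin-*P G p q))
  where
  leading : ∀ q → lin G (map (λ t → (c ℚ.* proj₁ t , a ++ proj₂ t)) q) ≡ c ℚ.* lin (λ b → G (a ++ b)) q
  leading [] = sym (ℚₚ.*-zeroʳ c)
  leading ((d , b) ∷ q) = trans (cong ((c ℚ.* d) ℚ.* G (a ++ b) ℚ.+_) (leading q))
    (solve 4 (λ c d x l → (c :* d) :* x :+ c :* l := c :* (d :* x :+ l)) refl
       c d (G (a ++ b)) (lin (λ b → G (a ++ b)) q))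

lin-comm : ∀ (H : Mon → Mon → ℚ) p q →
  lin (λ a → lin (λ b → H a b) q) p ≡ lin (λ b → lin (λ a → H a b) p) q
lin-comm H [] q = sym (lin-zero q)
lin-comm H ((c , a) ∷ p) q = begin
    c ℚ.* lin (H a) q ℚ.+ lin (λ a → lin (H a) q) p
  ≡⟨ cong₂ ℚ._+_ (sym (lin-*ˡ c (H a) q)) (lin-comm H p q) ⟩
    lin (λ b → c ℚ.* H a b) q ℚ.+ lin (λ b → lin (λ a → H a b) p) q
  ≡⟨ sym (lin-+ _ _ q) ⟩
    lin (λ b → c ℚ.* H a b ℚ.+ lin (λ a → H a b) p) q ∎
  where open ≡-Reasoning

lin-filter : ∀ {P : Mon → Set} (P? : ∀ a → Dec (P a)) G p →
  lin G p ≡ lin G (filter (P? ∘ proj₂) p) ℚ.+ lin G (filter (¬? ∘ P? ∘ proj₂) p)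
lin-filter P? G [] = refl
lin-filter P? G ((c , a) ∷ p) with P? a
... | yes _ = trans (cong (c ℚ.* G a ℚ.+_) (lin-filter P? G p))
  (sym (ℚₚ.+-assoc (c ℚ.* G a) (lin G (filter (P? ∘ proj₂) p)) (lin G (filter (¬? ∘ P? ∘ proj₂) p))))
... | no _ = trans (cong (c ℚ.* G a ℚ.+_) (lin-filter P? G p))
  (solve 3 (λ x y z → x :+ (y :+ z) := y :+ (x :+ z)) refl
     (c ℚ.* G a) (lin G (filter (P? ∘ proj₂) p)) (lin G (filter (¬? ∘ P? ∘ proj₂) p)))

χ≡0 : ∀ {a m} → ¬ (a ↭ m) → χ a m ≡ 0ℚ
χ≡0 {a} {m} ¬a↭m with a ↭? m
... | yes a↭m = ⊥-elim (¬a↭m a↭m)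
... | no _ = refl

module _ {G : Mon → ℚ} (G-resp : G Preserves _↭_ ⟶ _≡_) where

  lin-filter-↭ : ∀ a p → lin G (filter ((a ↭?_) ∘ proj₂) p) ≡ G a ℚ.* coeff↭ p a
  lin-filter-↭ a [] = sym (ℚₚ.*-zeroʳ (G a))
  lin-filter-↭ a ((c , b) ∷ p) with a ↭? b
  ... | yes a↭b = begin
      c ℚ.* G b ℚ.+ lin G (filter ((a ↭?_) ∘ proj₂) p)
    ≡⟨ cong₂ (λ x y → c ℚ.* x ℚ.+ y) (sym (G-resp a↭b)) (lin-filter-↭ a p) ⟩
      c ℚ.* G a ℚ.+ G a ℚ.* coeff↭ p a
    ≡⟨ solve 3 (λ c x l → c :* x :+ x :* l := x :* (c :* con 1ℚ :+ l)) refl c (G a) (coeff↭ p a) ⟩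
      G a ℚ.* (c ℚ.* 1ℚ ℚ.+ coeff↭ p a)
    ≡⟨ cong (λ x → G a ℚ.* (c ℚ.* x ℚ.+ coeff↭ p a)) (sym (χ≡1 (↭-sym a↭b))) ⟩
      G a ℚ.* (c ℚ.* χ b a ℚ.+ coeff↭ p a) ∎
    where open ≡-Reasoning
  ... | no ¬a↭b = begin
      lin G (filter ((a ↭?_) ∘ proj₂) p)
    ≡⟨ lin-filter-↭ a p ⟩
      G a ℚ.* coeff↭ p a
    ≡⟨ solve 3 (λ c x l → x :* l := x :* (c :* con 0ℚ :+ l)) refl c (G a) (coeff↭ p a) ⟩
      G a ℚ.* (c ℚ.* 0ℚ ℚ.+ coeff↭ p a)
    ≡⟨ cong (λ x → G a ℚ.* (c ℚ.* x ℚ.+ coeff↭ p a)) (sym (χ≡0 (¬a↭b ∘ ↭-sym))) ⟩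
      G a ℚ.* (c ℚ.* χ b a ℚ.+ coeff↭ p a) ∎
    where open ≡-Reasoning

-- The terms of p whose monomial is a permutation of its first monomial a
-- contribute G a · coeff↭ p a = 0; the others form a shorter polynomial
-- whose coefficients still vanish.
lin-vanish : ∀ {G} → G Preserves _↭_ ⟶ _≡_ →
  ∀ n p → length p ℕ.≤ n → (∀ m → coeff↭ p m ≡ 0ℚ) → lin G p ≡ 0ℚ
lin-vanish G-resp n [] _ _ = refl
lin-vanish {G} G-resp (suc n) p@((c , a) ∷ _) (ℕ.s≤s |p|≤1+n) p≡0 = begin
    lin G p
  ≡⟨ lin-filter (a ↭?_) G p ⟩
    lin G (filter (P? ∘ proj₂) p) ℚ.+ lin G rest
  ≡⟨ cong₂ ℚ._+_ (trans (lin-filter-↭ G-resp a p) (trans (cong (G a ℚ.*_) (p≡0 a)) (ℚₚ.*-zeroʳ (G a))))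
                 (lin-vanish G-resp n rest |rest|≤n rest≡0) ⟩
    0ℚ ∎
  where
  open ≡-Reasoning
  P? = a ↭?_
  rest = filter (¬? ∘ P? ∘ proj₂) p
  |rest|≤n : length rest ℕ.≤ n
  |rest|≤n = ℕₚ.≤-trans
    (ℕₚ.≤-pred (List.filter-notAll (¬? ∘ P? ∘ proj₂) p (here (λ ¬a↭a → ¬a↭a ↭-refl)))) |p|≤1+n
  rest≡0 : ∀ m → coeff↭ rest m ≡ 0ℚ
  rest≡0 m = begin
      coeff↭ rest m
    ≡⟨ sym (ℚₚ.+-identityˡ _) ⟩
      0ℚ ℚ.+ coeff↭ rest m
    ≡⟨ cong (ℚ._+ coeff↭ rest m) (sym (trans (lin-filter-↭ (χ-resp-↭ m) a p)
                                         (trans (cong (χ a m ℚ.*_) (p≡0 a)) (ℚₚ.*-zeroʳ (χ a m))))) ⟩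
      coeff↭ (filter (P? ∘ proj₂) p) m ℚ.+ coeff↭ rest m
    ≡⟨ sym (lin-filter P? (λ b → χ b m) p) ⟩
      coeff↭ p m
    ≡⟨ p≡0 m ⟩
      0ℚ ∎

lin-resp : ∀ {G} → G Preserves _↭_ ⟶ _≡_ → ∀ {p q} → p ≅ q → lin G p ≡ lin G q
lin-resp {G} G-resp {p} {q} p≅q = begin
    lin G p
  ≡⟨ solve 2 (λ x y → x := (x :+ con (ℚ.- 1ℚ) :* y) :+ y) refl (lin G p) (lin G q) ⟩
    (lin G p ℚ.+ ℚ.- 1ℚ ℚ.* lin G q) ℚ.+ lin G q
  ≡⟨ cong (ℚ._+ lin G q) (sym (lin-difference G)) ⟩
    lin G (p ++ scale (ℚ.- 1ℚ) q) ℚ.+ lin G q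
  ≡⟨ cong (ℚ._+ lin G q) (lin-vanish G-resp _ (p ++ scale (ℚ.- 1ℚ) q) ℕₚ.≤-refl difference≡0) ⟩
    0ℚ ℚ.+ lin G q
  ≡⟨ ℚₚ.+-identityˡ _ ⟩
    lin G q ∎
  where
  open ≡-Reasoning
  lin-difference : ∀ F → lin F (p ++ scale (ℚ.- 1ℚ) q) ≡ lin F p ℚ.+ ℚ.- 1ℚ ℚ.* lin F q
  lin-difference F = trans (lin-++ F p _) (cong (lin F p ℚ.+_) (lin-scale (ℚ.- 1ℚ) F q))
  difference≡0 : ∀ m → coeff↭ (p ++ scale (ℚ.- 1ℚ) q) m ≡ 0ℚ
  difference≡0 m = trans (lin-difference (λ a → χ a m))
    (trans (cong (λ x → x ℚ.+ ℚ.- 1ℚ ℚ.* coeff↭ q m) (coeff↭-≡ p≅q m))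
      (solve 1 (λ x → x :+ con (ℚ.- 1ℚ) :* x := con 0ℚ) refl (coeff↭ q m)))

-- Polynomials modulo ≅ form a commutative ring

≅-refl : ∀ {p} → p ≅ p
≅-refl = coeff↭-≅ λ _ → refl

≅-sym : ∀ {p q} → p ≅ q → q ≅ p
≅-sym p≅q = coeff↭-≅ λ m → sym (coeff↭-≡ p≅q m)

≅-trans : ∀ {p q r} → p ≅ q → q ≅ r → p ≅ r
≅-trans p≅q q≅r = coeff↭-≅ λ m → trans (coeff↭-≡ p≅q m) (coeff↭-≡ q≅r m)

≡⇒≅ : ∀ {p q} → p ≡ q → p ≅ q
≡⇒≅ refl = ≅-refl

coeff↭-+P : ∀ p q m → coeff↭ (p +P q) m ≡ coeff↭ p m ℚ.+ coeff↭ q m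
coeff↭-+P p q m = lin-++ (λ a → χ a m) p q

coeff↭-scale : ∀ k p m → coeff↭ (scale k p) m ≡ k ℚ.* coeff↭ p m
coeff↭-scale k p m = lin-scale k (λ a → χ a m) p

coeff↭-*P : ∀ p q m → coeff↭ (p *P q) m ≡ lin (λ a → lin (λ b → χ (a ++ b) m) q) p
coeff↭-*P p q m = lin-*P (λ a → χ a m) p q

private
  module Laws where
    open ≡-Reasoning

    +-cong : ∀ {p p′ q q′} → p ≅ p′ → q ≅ q′ → p +P q ≅ p′ +P q′
    +-cong {p} {p′} {q} {q′} p≅p′ q≅q′ = coeff↭-≅ λ m → begin
      coeff↭ (p +P q) m              ≡⟨ coeff↭-+P p q m ⟩
      coeff↭ p m ℚ.+ coeff↭ q m      ≡⟨ cong₂ ℚ._+_ (coeff↭-≡ p≅p′ m) (coeff↭-≡ q≅q′ m) ⟩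
      coeff↭ p′ m ℚ.+ coeff↭ q′ m    ≡⟨ sym (coeff↭-+P p′ q′ m) ⟩
      coeff↭ (p′ +P q′) m            ∎

    +-comm : ∀ p q → p +P q ≅ q +P p
    +-comm p q = coeff↭-≅ λ m → begin
      coeff↭ (p +P q) m              ≡⟨ coeff↭-+P p q m ⟩
      coeff↭ p m ℚ.+ coeff↭ q m      ≡⟨ ℚₚ.+-comm (coeff↭ p m) (coeff↭ q m) ⟩
      coeff↭ q m ℚ.+ coeff↭ p m      ≡⟨ sym (coeff↭-+P q p m) ⟩
      coeff↭ (q +P p) m              ∎

    +-assoc : ∀ p q r → (p +P q) +P r ≅ p +P (q +P r)
    +-assoc p q r = ≡⇒≅ (List.++-assoc p q r)

    +-identityˡ : ∀ p → 0P +P p ≅ p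
    +-identityˡ p = ≅-refl

    +-identityʳ : ∀ p → p +P 0P ≅ p
    +-identityʳ p = ≡⇒≅ (List.++-identityʳ p)

    -‿inverseˡ : ∀ p → scale (ℚ.- 1ℚ) p +P p ≅ 0P
    -‿inverseˡ p = coeff↭-≅ λ m → begin
        coeff↭ (scale (ℚ.- 1ℚ) p +P p) m
      ≡⟨ coeff↭-+P (scale (ℚ.- 1ℚ) p) p m ⟩
        coeff↭ (scale (ℚ.- 1ℚ) p) m ℚ.+ coeff↭ p m
      ≡⟨ cong (ℚ._+ coeff↭ p m) (coeff↭-scale (ℚ.- 1ℚ) p m) ⟩
        ℚ.- 1ℚ ℚ.* coeff↭ p m ℚ.+ coeff↭ p m
      ≡⟨ solve 1 (λ x → con (ℚ.- 1ℚ) :* x :+ x := con 0ℚ) refl (coeff↭ p m) ⟩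
        0ℚ ∎

    -‿inverseʳ : ∀ p → p +P scale (ℚ.- 1ℚ) p ≅ 0P
    -‿inverseʳ p = ≅-trans (+-comm p (scale (ℚ.- 1ℚ) p)) (-‿inverseˡ p)

    -‿cong : ∀ {p q} → p ≅ q → scale (ℚ.- 1ℚ) p ≅ scale (ℚ.- 1ℚ) q
    -‿cong {p} {q} p≅q = coeff↭-≅ λ m →
      trans (coeff↭-scale (ℚ.- 1ℚ) p m)
            (trans (cong (ℚ.- 1ℚ ℚ.*_) (coeff↭-≡ p≅q m)) (sym (coeff↭-scale (ℚ.- 1ℚ) q m)))

    *-cong : ∀ {p p′ q q′} → p ≅ p′ → q ≅ q′ → p *P q ≅ p′ *P q′
    *-cong {p} {p′} {q} {q′} p≅p′ q≅q′ = coeff↭-≅ λ m → begin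
        coeff↭ (p *P q) m
      ≡⟨ coeff↭-*P p q m ⟩
        lin (λ a → lin (λ b → χ (a ++ b) m) q) p
      ≡⟨ lin-resp (λ a↭a′ → lin-cong q λ b → χ-resp-↭ m (↭.++⁺ʳ b a↭a′)) p≅p′ ⟩
        lin (λ a → lin (λ b → χ (a ++ b) m) q) p′
      ≡⟨ lin-cong p′ (λ a → lin-resp (λ b↭b′ → χ-resp-↭ m (↭.++⁺ˡ a b↭b′)) q≅q′) ⟩
        lin (λ a → lin (λ b → χ (a ++ b) m) q′) p′
      ≡⟨ sym (coeff↭-*P p′ q′ m) ⟩
        coeff↭ (p′ *P q′) m ∎

    *-comm : ∀ p q → p *P q ≅ q *P p
    *-comm p q = coeff↭-≅ λ m → begin
        coeff↭ (p *P q) m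
      ≡⟨ coeff↭-*P p q m ⟩
        lin (λ a → lin (λ b → χ (a ++ b) m) q) p
      ≡⟨ lin-comm (λ a b → χ (a ++ b) m) p q ⟩
        lin (λ b → lin (λ a → χ (a ++ b) m) p) q
      ≡⟨ lin-cong q (λ b → lin-cong p (λ a → χ-resp-↭ m (↭.++-comm a b))) ⟩
        lin (λ b → lin (λ a → χ (b ++ a) m) p) q
      ≡⟨ sym (coeff↭-*P q p m) ⟩
        coeff↭ (q *P p) m ∎

    *-assoc : ∀ p q r → (p *P q) *P r ≅ p *P (q *P r)
    *-assoc p q r = coeff↭-≅ λ m → begin
      coeff↭ ((p *P q) *P r) m
        ≡⟨ coeff↭-*P (p *P q) r m ⟩
      lin (λ ab → lin (λ c → χ (ab ++ c) m) r) (p *P q)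
        ≡⟨ lin-*P _ p q ⟩
      lin (λ a → lin (λ b → lin (λ c → χ ((a ++ b) ++ c) m) r) q) p
        ≡⟨ lin-cong p (λ a → lin-cong q (λ b → lin-cong r (λ c → cong (λ abc → χ abc m) (List.++-assoc a b c)))) ⟩
      lin (λ a → lin (λ b → lin (λ c → χ (a ++ (b ++ c)) m) r) q) p
        ≡⟨ lin-cong p (λ a → sym (lin-*P (λ bc → χ (a ++ bc) m) q r)) ⟩
      lin (λ a → lin (λ bc → χ (a ++ bc) m) (q *P r)) p
        ≡⟨ sym (coeff↭-*P p (q *P r) m) ⟩
      coeff↭ (p *P (q *P r)) m ∎

    *-identityˡ : ∀ p → 1P *P p ≅ p
    *-identityˡ p = coeff↭-≅ λ m →
      trans (coeff↭-*P 1P p m) (trans (ℚₚ.+-identityʳ _) (ℚₚ.*-identityˡ _))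

    *-identityʳ : ∀ p → p *P 1P ≅ p
    *-identityʳ p = ≅-trans (*-comm p 1P) (*-identityˡ p)

    distribˡ : ∀ p q r → p *P (q +P r) ≅ p *P q +P p *P r
    distribˡ p q r = coeff↭-≅ λ m → begin
      coeff↭ (p *P (q +P r)) m
        ≡⟨ coeff↭-*P p (q +P r) m ⟩
      lin (λ a → lin (λ b → χ (a ++ b) m) (q +P r)) p
        ≡⟨ lin-cong p (λ a → lin-++ (λ b → χ (a ++ b) m) q r) ⟩
      lin (λ a → lin (λ b → χ (a ++ b) m) q ℚ.+ lin (λ b → χ (a ++ b) m) r) p
        ≡⟨ lin-+ _ _ p ⟩
      lin (λ a → lin (λ b → χ (a ++ b) m) q) p ℚ.+ lin (λ a → lin (λ b → χ (a ++ b) m) r) p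
        ≡⟨ sym (cong₂ ℚ._+_ (coeff↭-*P p q m) (coeff↭-*P p r m)) ⟩
      coeff↭ (p *P q) m ℚ.+ coeff↭ (p *P r) m
        ≡⟨ sym (coeff↭-+P (p *P q) (p *P r) m) ⟩
      coeff↭ (p *P q +P p *P r) m ∎

    distribʳ : ∀ p q r → (q +P r) *P p ≅ q *P p +P r *P p
    distribʳ p q r =
      ≅-trans (*-comm (q +P r) p) (≅-trans (distribˡ p q r) (+-cong (*-comm p q) (*-comm p r)))

ℙ : CommutativeRing 0ℓ 0ℓ
ℙ = record
  { Carrier = Poly
  ; _≈_ = _≅_
  ; _+_ = _+P_
  ; _*_ = _*P_
  ; -_ = scale (ℚ.- 1ℚ)
  ; 0# = 0P
  ; 1# = 1P
  ; isCommutativeRing = record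
    { isRing = record
      { +-isAbelianGroup = record
        { isGroup = record
          { isMonoid = record
            { isSemigroup = record
              { isMagma = record
                { isEquivalence = record { refl = ≅-refl ; sym = ≅-sym ; trans = ≅-trans }
                ; ∙-cong = Laws.+-cong }
              ; assoc = Laws.+-assoc }
            ; identity = Laws.+-identityˡ , Laws.+-identityʳ }
          ; inverse = Laws.-‿inverseˡ , Laws.-‿inverseʳ
          ; ⁻¹-cong = Laws.-‿cong }
        ; comm = Laws.+-comm }
      ; *-cong = Laws.*-cong
      ; *-assoc = Laws.*-assoc
      ; *-identity = Laws.*-identityˡ , Laws.*-identityʳ
      ; distrib = Laws.distribˡ , Laws.distribʳ }
    ; *-comm = Laws.*-comm }
  }

open CommutativeRing ℙ public
  using (+-cong; +-comm; +-assoc; +-identityʳ; *-cong; *-comm; *-assoc; *-identityˡ; *-identityʳ;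
         distribˡ; zeroʳ; setoid)
open import Algebra.Solver.Ring.NaturalCoefficients.Default (CommutativeRing.commutativeSemiring ℙ)
  using () renaming (solve to solve-ℙ; _:+_ to _⊕_; _:*_ to _⊗_; _:=_ to _≐_)

countVar-↭ : ∀ x {a b} → a ↭ b → countVar x a ≡ countVar x b
countVar-↭ x Perm.refl = refl
countVar-↭ x (prep y a↭b) with varEq x y
... | true = cong suc (countVar-↭ x a↭b)
... | false = countVar-↭ x a↭b
countVar-↭ x (swap y z a↭b) with varEq x y | varEq x z
... | true | true = cong (suc ∘ suc) (countVar-↭ x a↭b)
... | true | false = cong suc (countVar-↭ x a↭b)
... | false | true = cong suc (countVar-↭ x a↭b)
... | false | false = countVar-↭ x a↭b
countVar-↭ x (Perm.trans a↭b b↭c) = trans (countVar-↭ x a↭b) (countVar-↭ x b↭c)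

all-↭ : ∀ (P : Var → Bool) {xs ys} → xs ↭ ys → all P xs ≡ all P ys
all-↭ P Perm.refl = refl
all-↭ P (prep x xs↭ys) = cong (P x ∧_) (all-↭ P xs↭ys)
all-↭ P (swap x y xs↭ys) = trans (cong (λ b → P x ∧ (P y ∧ b)) (all-↭ P xs↭ys))
  (trans (sym (Boolₚ.∧-assoc (P x) (P y) _))
    (trans (cong (_∧ _) (Boolₚ.∧-comm (P x) (P y))) (Boolₚ.∧-assoc (P y) (P x) _)))
all-↭ P (Perm.trans xs↭ys ys↭zs) = trans (all-↭ P xs↭ys) (all-↭ P ys↭zs)

all-cong : ∀ {P Q : Var → Bool} xs → (∀ x → P x ≡ Q x) → all P xs ≡ all Q xs
all-cong [] P≗Q = refl
all-cong (x ∷ xs) P≗Q = cong₂ _∧_ (P≗Q x) (all-cong xs P≗Q)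

sameMon-↭ : ∀ {a b} m → a ↭ b → sameMon a m ≡ sameMon b m
sameMon-↭ {a} {b} m a↭b =
  trans (all-cong (a ++ m) (λ x → cong (ℕ._≡ᵇ countVar x m) (countVar-↭ x a↭b)))
        (all-↭ (λ x → countVar x b ℕ.≡ᵇ countVar x m) (↭.++⁺ʳ m a↭b))

indicator : Bool → ℚ
indicator true = 1ℚ
indicator false = 0ℚ

coeff-lin : ∀ p m → coeff p m ≡ lin (λ a → indicator (sameMon a m)) p
coeff-lin [] m = refl
coeff-lin ((c , a) ∷ p) m = cong₂ ℚ._+_ (if≡* (sameMon a m)) (coeff-lin p m)
  where
  if≡* : ∀ b → (if b then c else 0ℚ) ≡ c ℚ.* indicator b
  if≡* true = sym (ℚₚ.*-identityʳ c)
  if≡* false = sym (ℚₚ.*-zeroʳ c)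

≅⇒≈P : ∀ {p q} → p ≅ q → p ≈P q
≅⇒≈P {p} {q} p≅q m = trans (coeff-lin p m)
  (trans (lin-resp (cong indicator ∘ sameMon-↭ m) p≅q) (sym (coeff-lin q m)))

-- C'' is a derivation

mono : Mon → Poly
mono a = (1ℚ , a) ∷ []

coeff↭-mono : ∀ a m → coeff↭ (mono a) m ≡ χ a m
coeff↭-mono a m = trans (ℚₚ.+-identityʳ _) (ℚₚ.*-identityˡ _)

mono-cong : ∀ {a b} → a ↭ b → mono a ≅ mono b
mono-cong {a} {b} a↭b = coeff↭-≅ λ m →
  trans (coeff↭-mono a m) (trans (χ-resp-↭ m a↭b) (sym (coeff↭-mono b m)))

mono-++ : ∀ a b → mono (a ++ b) ≅ mono a *P mono b
mono-++ a b = ≡⇒≅ (cong (λ c → (c , a ++ b) ∷ []) (sym (ℚₚ.*-identityˡ 1ℚ)))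

module _ where
  open import Relation.Binary.Reasoning.Setoid setoid

  dMon-++ : ∀ a b → dMon (a ++ b) ≅ dMon a *P mono b +P mono a *P dMon b
  dMon-++ [] b = ≅-sym (*-identityˡ (dMon b))
  dMon-++ (x ∷ a) b = begin
      dVar x *P mono (a ++ b) +P mono [ x ] *P dMon (a ++ b)
    ≈⟨ +-cong (*-cong (≅-refl {dVar x}) (mono-++ a b)) (*-cong (≅-refl {mono [ x ]}) (dMon-++ a b)) ⟩
      dVar x *P (mono a *P mono b) +P mono [ x ] *P (dMon a *P mono b +P mono a *P dMon b)
    ≈⟨ solve-ℙ 6 (λ dx ma mb mx da db → dx ⊗ (ma ⊗ mb) ⊕ mx ⊗ (da ⊗ mb ⊕ ma ⊗ db)
                                     ≐ (dx ⊗ ma ⊕ mx ⊗ da) ⊗ mb ⊕ (mx ⊗ ma) ⊗ db) ≅-refl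
         (dVar x) (mono a) (mono b) (mono [ x ]) (dMon a) (dMon b) ⟩
      dMon (x ∷ a) *P mono b +P (mono [ x ] *P mono a) *P dMon b
    ≈⟨ +-cong (≅-refl {dMon (x ∷ a) *P mono b}) (*-cong (≅-sym (mono-++ [ x ] a)) (≅-refl {dMon b})) ⟩
      dMon (x ∷ a) *P mono b +P mono (x ∷ a) *P dMon b ∎

  dMon-↭ : ∀ {a b} → a ↭ b → dMon a ≅ dMon b
  dMon-↭ Perm.refl = ≅-refl
  dMon-↭ (prep x a↭b) =
    +-cong (*-cong (≅-refl {dVar x}) (mono-cong a↭b)) (*-cong (≅-refl {mono [ x ]}) (dMon-↭ a↭b))
  dMon-↭ (swap {xs = a} {ys = b} x y a↭b) = begin
      dVar x *P mono (y ∷ a) +P mono [ x ] *P (dVar y *P mono a +P mono [ y ] *P dMon a)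
    ≈⟨ +-cong (*-cong (≅-refl {dVar x}) (≅-trans (mono-++ [ y ] a) (*-cong (≅-refl {mono [ y ]}) (mono-cong a↭b))))
              (*-cong (≅-refl {mono [ x ]})
                      (+-cong (*-cong (≅-refl {dVar y}) (mono-cong a↭b)) (*-cong (≅-refl {mono [ y ]}) (dMon-↭ a↭b)))) ⟩
      dVar x *P (mono [ y ] *P mono b) +P mono [ x ] *P (dVar y *P mono b +P mono [ y ] *P dMon b)
    ≈⟨ solve-ℙ 6 (λ dx dy mx my mb db → dx ⊗ (my ⊗ mb) ⊕ mx ⊗ (dy ⊗ mb ⊕ my ⊗ db)
                                     ≐ dy ⊗ (mx ⊗ mb) ⊕ my ⊗ (dx ⊗ mb ⊕ mx ⊗ db)) ≅-refl
         (dVar x) (dVar y) (mono [ x ]) (mono [ y ]) (mono b) (dMon b) ⟩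
      dVar y *P (mono [ x ] *P mono b) +P mono [ y ] *P (dVar x *P mono b +P mono [ x ] *P dMon b)
    ≈⟨ +-cong (*-cong (≅-refl {dVar y}) (≅-sym (mono-++ [ x ] b))) ≅-refl ⟩
      dVar y *P mono (x ∷ b) +P mono [ y ] *P (dVar x *P mono b +P mono [ x ] *P dMon b) ∎
  dMon-↭ (Perm.trans a↭b b↭c) = ≅-trans (dMon-↭ a↭b) (dMon-↭ b↭c)

lin-C'' : ∀ G p → lin G (C'' p) ≡ lin (λ a → lin G (dMon a)) p
lin-C'' G [] = refl
lin-C'' G ((c , a) ∷ p) =
  trans (lin-++ G (scale c (dMon a)) (C'' p)) (cong₂ ℚ._+_ (lin-scale c G (dMon a)) (lin-C'' G p))

C''-cong : ∀ {p q} → p ≅ q → C'' p ≅ C'' q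
C''-cong {p} {q} p≅q = coeff↭-≅ λ m → trans (lin-C'' _ p)
  (trans (lin-resp (λ a↭b → coeff↭-≡ (dMon-↭ a↭b) m) p≅q) (sym (lin-C'' _ q)))

C''-+ : ∀ p q → C'' (p +P q) ≅ C'' p +P C'' q
C''-+ p q = coeff↭-≅ λ m → trans (lin-C'' _ (p +P q)) (trans (lin-++ _ p q)
  (sym (trans (coeff↭-+P (C'' p) (C'' q) m) (cong₂ ℚ._+_ (lin-C'' _ p) (lin-C'' _ q)))))

C''-scale : ∀ k p → C'' (scale k p) ≅ scale k (C'' p)
C''-scale k p = coeff↭-≅ λ m → trans (lin-C'' _ (scale k p)) (trans (lin-scale k _ p)
  (sym (trans (coeff↭-scale k (C'' p) m) (cong (k ℚ.*_) (lin-C'' _ p)))))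

coeff↭-*P-mono : ∀ p b m → coeff↭ (p *P mono b) m ≡ lin (λ a → χ (a ++ b) m) p
coeff↭-*P-mono p b m = trans (coeff↭-*P p (mono b) m)
  (lin-cong p (λ a → trans (ℚₚ.+-identityʳ _) (ℚₚ.*-identityˡ _)))

coeff↭-mono-*P : ∀ a q m → coeff↭ (mono a *P q) m ≡ lin (λ b → χ (a ++ b) m) q
coeff↭-mono-*P a q m = trans (coeff↭-*P (mono a) q m) (trans (ℚₚ.+-identityʳ _) (ℚₚ.*-identityˡ _))

C''-* : ∀ p q → C'' (p *P q) ≅ C'' p *P q +P p *P C'' q
C''-* p q = coeff↭-≅ λ m → begin
    coeff↭ (C'' (p *P q)) m
  ≡⟨ trans (lin-C'' _ (p *P q)) (lin-*P _ p q) ⟩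
    lin (λ a → lin (λ b → coeff↭ (dMon (a ++ b)) m) q) p
  ≡⟨ lin-cong p (λ a → lin-cong q (λ b →
       trans (coeff↭-≡ (dMon-++ a b) m) (coeff↭-+P (dMon a *P mono b) (mono a *P dMon b) m))) ⟩
    lin (λ a → lin (λ b → coeff↭ (dMon a *P mono b) m ℚ.+ coeff↭ (mono a *P dMon b) m) q) p
  ≡⟨ trans (lin-cong p (λ a → lin-+ _ _ q)) (lin-+ _ _ p) ⟩
    lin (λ a → lin (λ b → coeff↭ (dMon a *P mono b) m) q) p ℚ.+
    lin (λ a → lin (λ b → coeff↭ (mono a *P dMon b) m) q) p
  ≡⟨ cong₂ ℚ._+_ (derivative-left m) (derivative-right m) ⟩
    coeff↭ (C'' p *P q) m ℚ.+ coeff↭ (p *P C'' q) m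
  ≡⟨ sym (coeff↭-+P (C'' p *P q) (p *P C'' q) m) ⟩
    coeff↭ (C'' p *P q +P p *P C'' q) m ∎
  where
  open ≡-Reasoning
  derivative-left : ∀ m → lin (λ a → lin (λ b → coeff↭ (dMon a *P mono b) m) q) p ≡ coeff↭ (C'' p *P q) m
  derivative-left m = begin
      lin (λ a → lin (λ b → coeff↭ (dMon a *P mono b) m) q) p
    ≡⟨ lin-cong p (λ a → lin-cong q (λ b → coeff↭-*P-mono (dMon a) b m)) ⟩
      lin (λ a → lin (λ b → lin (λ c → χ (c ++ b) m) (dMon a)) q) p
    ≡⟨ lin-cong p (λ a → sym (lin-comm (λ c b → χ (c ++ b) m) (dMon a) q)) ⟩
      lin (λ a → lin (λ c → lin (λ b → χ (c ++ b) m) q) (dMon a)) p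
    ≡⟨ sym (trans (coeff↭-*P (C'' p) q m) (lin-C'' _ p)) ⟩
      coeff↭ (C'' p *P q) m ∎
  derivative-right : ∀ m → lin (λ a → lin (λ b → coeff↭ (mono a *P dMon b) m) q) p ≡ coeff↭ (p *P C'' q) m
  derivative-right m = begin
      lin (λ a → lin (λ b → coeff↭ (mono a *P dMon b) m) q) p
    ≡⟨ lin-cong p (λ a → lin-cong q (λ b → coeff↭-mono-*P a (dMon b) m)) ⟩
      lin (λ a → lin (λ b → lin (λ c → χ (a ++ c) m) (dMon b)) q) p
    ≡⟨ lin-cong p (λ a → sym (lin-C'' _ q)) ⟩
      lin (λ a → lin (λ c → χ (a ++ c) m) (C'' q)) p
    ≡⟨ sym (coeff↭-*P p (C'' q) m) ⟩
      coeff↭ (p *P C'' q) m ∎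

sumP-zero : ∀ (xs : List A) → sumP (map (λ _ → 0P) xs) ≡ 0P
sumP-zero [] = refl
sumP-zero (x ∷ xs) = sumP-zero xs

sumP-cong : ∀ {F G : A → Poly} xs → (∀ x → F x ≅ G x) → sumP (map F xs) ≅ sumP (map G xs)
sumP-cong [] F≅G = ≅-refl
sumP-cong (x ∷ xs) F≅G = +-cong (F≅G x) (sumP-cong xs F≅G)

sumP-congᴬ : ∀ {F G : A → Poly} {xs} → All (λ x → F x ≅ G x) xs → sumP (map F xs) ≅ sumP (map G xs)
sumP-congᴬ [] = ≅-refl
sumP-congᴬ (Fx≅Gx ∷ F≅G) = +-cong Fx≅Gx (sumP-congᴬ F≅G)

sumP-map : ∀ (F : B → Poly) (G : A → B) xs → sumP (map F (map G xs)) ≡ sumP (map (F ∘ G) xs)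
sumP-map F G xs = cong sumP (sym (List.map-∘ xs))

sumP-*ˡ : ∀ c (F : A → Poly) xs → c *P sumP (map F xs) ≅ sumP (map (λ x → c *P F x) xs)
sumP-*ˡ c F [] = zeroʳ c
sumP-*ˡ c F (x ∷ xs) = ≅-trans (distribˡ c (F x) _) (+-cong ≅-refl (sumP-*ˡ c F xs))

sumP-+ : ∀ (F G : A → Poly) xs → sumP (map (λ x → F x +P G x) xs) ≅ sumP (map F xs) +P sumP (map G xs)
sumP-+ F G [] = ≅-refl
sumP-+ F G (x ∷ xs) = ≅-trans (+-cong (≅-refl {F x +P G x}) (sumP-+ F G xs))
  (solve-ℙ 4 (λ a b c d → (a ⊕ b) ⊕ (c ⊕ d) ≐ (a ⊕ c) ⊕ (b ⊕ d)) ≅-refl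
     (F x) (G x) (sumP (map F xs)) (sumP (map G xs)))

sumP-++ : ∀ (ps qs : List Poly) → sumP (ps ++ qs) ≅ sumP ps +P sumP qs
sumP-++ [] qs = ≅-refl
sumP-++ (p ∷ ps) qs = ≅-trans (+-cong (≅-refl {p}) (sumP-++ ps qs)) (≅-sym (+-assoc p (sumP ps) (sumP qs)))

sumP-concatMap : ∀ (F : B → Poly) (G : A → List B) xs →
  sumP (map F (concatMap G xs)) ≅ sumP (map (λ x → sumP (map F (G x))) xs)
sumP-concatMap F G [] = ≅-refl
sumP-concatMap F G (x ∷ xs) = ≅-trans (≡⇒≅ (cong sumP (List.map-++ F (G x) (concatMap G xs))))
  (≅-trans (sumP-++ (map F (G x)) (map F (concatMap G xs))) (+-cong ≅-refl (sumP-concatMap F G xs)))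

sumP-comm : ∀ (F : A → B → Poly) xs (ys : List B) →
  sumP (map (λ x → sumP (map (F x) ys)) xs) ≅ sumP (map (λ y → sumP (map (λ x → F x y) xs)) ys)
sumP-comm F [] ys = ≡⇒≅ (sym (sumP-zero ys))
sumP-comm F (x ∷ xs) ys = ≅-trans (+-cong (≅-refl {sumP (map (F x) ys)}) (sumP-comm F xs ys))
  (≅-sym (sumP-+ (F x) (λ y → sumP (map (λ x → F x y) xs)) ys))

C''-sumP : ∀ (F : A → Poly) xs → C'' (sumP (map F xs)) ≅ sumP (map (C'' ∘ F) xs)
C''-sumP F [] = ≅-refl
C''-sumP F (x ∷ xs) = ≅-trans (C''-+ (F x) _) (+-cong ≅-refl (C''-sumP F xs))

map-applyUpTo-suc : ∀ (F : ℕ → B) k → map F (applyUpTo suc k) ≡ map (F ∘ suc) (upTo k)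
map-applyUpTo-suc F k = trans (List.map-applyUpTo suc F k) (sym (List.map-applyUpTo id (F ∘ suc) k))

sumP-upTo-suc : ∀ (F : ℕ → Poly) k → sumP (map F (upTo (suc k))) ≡ F 0 +P sumP (map (F ∘ suc) (upTo k))
sumP-upTo-suc F k = cong (λ xs → F 0 +P sumP xs) (map-applyUpTo-suc F k)

private
  *-mkℚ : ∀ x y → x ℚ.* y ≡ ((↥ x ℤ.* ↥ y) / (↧ₙ x ℕ.* ↧ₙ y)) {{ℕₚ.m*n≢0 (↧ₙ x) (↧ₙ y)}}
  *-mkℚ (ℚ.mkℚ _ _ _) (ℚ.mkℚ _ _ _) = refl

  ↥1/n : ∀ n .{{_ : NonZero n}} → ↥ (+ 1 / n) ≡ + 1
  ↥1/n n = trans (sym (ℤₚ.*-identityʳ _))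
    (trans (cong (↥ (+ 1 / n) ℤ.*_) (sym (ℤ.gcd-zeroˡ (+ n)))) (ℚₚ.↥-/ (+ 1) n))

  ↧1/n : ∀ n .{{_ : NonZero n}} → ↧ₙ (+ 1 / n) ≡ n
  ↧1/n n = ℤₚ.+-injective (trans (sym (ℤₚ.*-identityʳ _))
    (trans (cong (↧ (+ 1 / n) ℤ.*_) (sym (ℤ.gcd-zeroˡ (+ n)))) (ℚₚ.↧-/ (+ 1) n)))

1/m*1/n≡1/[m*n] : ∀ m n .{{_ : NonZero m}} .{{_ : NonZero n}} →
  (+ 1 / m) ℚ.* (+ 1 / n) ≡ (+ 1 / (m ℕ.* n)) {{ℕₚ.m*n≢0 m n}}
1/m*1/n≡1/[m*n] m n = trans (*-mkℚ (+ 1 / m) (+ 1 / n))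
  (ℚₚ./-cong {{ℕₚ.m*n≢0 (↧ₙ (+ 1 / m)) (↧ₙ (+ 1 / n))}} {{ℕₚ.m*n≢0 m n}}
     (cong₂ ℤ._*_ (↥1/n m) (↥1/n n)) (cong₂ ℕ._*_ (↧1/n m) (↧1/n n)))

invFact-suc : ∀ n → invFact (suc n) ≡ (+ 1 / suc n) ℚ.* invFact n
invFact-suc n = sym (1/m*1/n≡1/[m*n] (suc n) (n !) {{_}} {{n !≢0}})

constP : ℚ → Poly
constP k = (k , []) ∷ []

scale≅constP-* : ∀ k p → scale k p ≅ constP k *P p
scale≅constP-* k p = coeff↭-≅ λ m → trans (coeff↭-scale k p m) (sym (trans (coeff↭-*P (constP k) p m) (ℚₚ.+-identityʳ _)))

scale-cong : ∀ k {p q} → p ≅ q → scale k p ≅ scale k q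
scale-cong k {p} {q} p≅q =
  ≅-trans (scale≅constP-* k p) (≅-trans (*-cong (≅-refl {constP k}) p≅q) (≅-sym (scale≅constP-* k q)))

power : Poly → ℕ → Poly
power x a = prodP (map (λ _ → x) (upTo a))

h-cons : ∀ x xs j → h j (x ∷ xs) ≡ sumP (map (λ a → power x a *P h (j ∸ a) xs) (upTo (suc j)))
h-cons x xs zero = refl
h-cons x xs (suc j) = refl

h-zero-cons : ∀ x xs → h 0 (x ∷ xs) ≅ h 0 xs
h-zero-cons x xs = ≅-trans (+-identityʳ _) (*-identityˡ (h 0 xs))

h-suc-cons : ∀ x xs j → h (suc j) (x ∷ xs) ≅ h (suc j) xs +P x *P h j (x ∷ xs)
h-suc-cons x xs j = +-cong (*-identityˡ (h (suc j) xs)) (begin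
    sumP (map (λ a → power x a *P h (suc j ∸ a) xs) (applyUpTo suc (suc j)))
  ≡⟨ cong sumP (map-applyUpTo-suc _ (suc j)) ⟩
    sumP (map (λ a → power x (suc a) *P h (j ∸ a) xs) (upTo (suc j)))
  ≈⟨ sumP-cong (upTo (suc j)) (λ a →
       ≅-trans (*-cong (≡⇒≅ (power-suc a)) (≅-refl {h (j ∸ a) xs})) (*-assoc x (power x a) (h (j ∸ a) xs))) ⟩
    sumP (map (λ a → x *P (power x a *P h (j ∸ a) xs)) (upTo (suc j)))
  ≈⟨ ≅-sym (sumP-*ˡ x _ (upTo (suc j))) ⟩
    x *P sumP (map (λ a → power x a *P h (j ∸ a) xs) (upTo (suc j)))
  ≡⟨ cong (x *P_) (sym (h-cons x xs j)) ⟩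
    x *P h j (x ∷ xs) ∎)
  where
  open import Relation.Binary.Reasoning.Setoid setoid
  power-suc : ∀ a → power x (suc a) ≡ x *P power x a
  power-suc a = cong (λ xs → x *P prodP xs) (map-applyUpTo-suc (λ _ → x) a)

≤ᵇ-false : ∀ {m n} → n ℕ.< m → (m ≤ᵇ n) ≡ false
≤ᵇ-false {m} {n} n<m with m ≤ᵇ n in m≤ᵇn
... | false = refl
... | true = ⊥-elim (ℕₚ.<⇒≱ n<m (ℕₚ.≤ᵇ⇒≤ m n (Equivalence.from Boolₚ.T-≡ m≤ᵇn)))

φ-below : ∀ xs {n} → n ℕ.< length xs → φ xs n ≡ 0P
φ-below (x ∷ xs) {n} n<l =
  cong (λ b → if b then scale (invFact n) (h (n ∸ suc (length xs)) (x ∷ xs)) else 0P) (≤ᵇ-false n<l)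

φ-from : ∀ xs j → φ xs (length xs ℕ.+ j) ≅ scale (invFact (length xs ℕ.+ j)) (h j xs)
φ-from [] zero = ≅-refl
φ-from [] (suc j) = ≅-refl
φ-from (x ∷ xs) j = ≡⇒≅ (trans
  (cong (λ b → if b then scale (invFact (l ℕ.+ j)) (h (l ℕ.+ j ∸ l) (x ∷ xs)) else 0P)
        (Equivalence.to Boolₚ.T-≡ (ℕₚ.≤⇒≤ᵇ (ℕₚ.m≤m+n l j))))
  (cong (λ i → scale (invFact (l ℕ.+ j)) (h i (x ∷ xs))) (ℕₚ.m+n∸m≡n l j)))
  where l = length (x ∷ xs)

scale-invFact-suc : ∀ n x {H H₁ H₂} → H ≅ H₁ +P x *P H₂ →
  scale (invFact (suc n)) H ≅ scale (+ 1 / suc n) (scale (invFact n) H₁ +P x *P scale (invFact n) H₂)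
scale-invFact-suc n x {H} {H₁} {H₂} H≅H₁+xH₂ = begin
    scale (invFact (suc n)) H
  ≈⟨ scale≅constP-* (invFact (suc n)) H ⟩
    constP (invFact (suc n)) *P H
  ≡⟨ cong (λ k → constP k *P H) (invFact-suc n) ⟩
    (constP c *P constP i) *P H
  ≈⟨ *-cong (≅-refl {constP c *P constP i}) H≅H₁+xH₂ ⟩
    (constP c *P constP i) *P (H₁ +P x *P H₂)
  ≈⟨ solve-ℙ 5 (λ c i h₁ x h₂ → (c ⊗ i) ⊗ (h₁ ⊕ x ⊗ h₂) ≐ c ⊗ (i ⊗ h₁ ⊕ x ⊗ (i ⊗ h₂))) ≅-refl
       (constP c) (constP i) H₁ x H₂ ⟩
    constP c *P (constP i *P H₁ +P x *P (constP i *P H₂))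
  ≈⟨ ≅-sym (≅-trans (scale≅constP-* c _) (*-cong (≅-refl {constP c})
       (+-cong (scale≅constP-* i H₁) (*-cong (≅-refl {x}) (scale≅constP-* i H₂))))) ⟩
    scale c (scale i H₁ +P x *P scale i H₂) ∎
  where
  open import Relation.Binary.Reasoning.Setoid setoid
  c = + 1 / suc n
  i = invFact n

φ-suc-from : ∀ x xs j → let n = length xs ℕ.+ j in
  φ (x ∷ xs) (suc n) ≅ scale (+ 1 / suc n) (φ xs n +P x *P φ (x ∷ xs) n)
φ-suc-from x xs zero =
  ≅-trans (φ-from (x ∷ xs) 0)
    (≅-trans (scale-invFact-suc (l ℕ.+ 0) x h₀≅)
      (scale-cong (+ 1 / suc (l ℕ.+ 0)) (+-cong (≅-sym (φ-from xs 0)) (≡⇒≅ (cong (x *P_) (sym φ₀≡0))))))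
  where
  l = length xs
  h₀≅ : h 0 (x ∷ xs) ≅ h 0 xs +P x *P 0P
  h₀≅ = ≅-trans (h-zero-cons x xs) (≅-sym (≅-trans (+-cong ≅-refl (zeroʳ x)) (+-identityʳ _)))
  φ₀≡0 : φ (x ∷ xs) (l ℕ.+ 0) ≡ 0P
  φ₀≡0 = φ-below (x ∷ xs) (ℕ.s≤s (ℕₚ.≤-reflexive (ℕₚ.+-identityʳ l)))
φ-suc-from x xs (suc j) =
  ≅-trans (φ-from (x ∷ xs) (suc j))
    (≅-trans (scale-invFact-suc (l ℕ.+ suc j) x (h-suc-cons x xs j))
      (scale-cong (+ 1 / suc (l ℕ.+ suc j)) (+-cong (≅-sym (φ-from xs (suc j))) (*-cong (≅-refl {x}) (≅-sym φ≅)))))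
  where
  l = length xs
  φ≅ : φ (x ∷ xs) (l ℕ.+ suc j) ≅ scale (invFact (l ℕ.+ suc j)) (h j (x ∷ xs))
  φ≅ = subst (λ n → φ (x ∷ xs) n ≅ scale (invFact n) (h j (x ∷ xs))) (sym (ℕₚ.+-suc l j)) (φ-from (x ∷ xs) j)

φ-suc : ∀ x xs n → φ (x ∷ xs) (suc n) ≅ scale (+ 1 / suc n) (φ xs n +P x *P φ (x ∷ xs) n)
φ-suc x xs n with ℕₚ.≤-<-connex (length xs) n
... | inj₁ l≤n with ℕₚ.m≤n⇒∃[o]m+o≡n l≤n
...   | j , refl = φ-suc-from x xs j
φ-suc x xs n | inj₂ n<l = begin
    φ (x ∷ xs) (suc n)
  ≡⟨ φ-below (x ∷ xs) (ℕ.s≤s n<l) ⟩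
    scale (+ 1 / suc n) (0P +P 0P)
  ≈⟨ scale-cong (+ 1 / suc n) (≅-sym (+-cong (≡⇒≅ (φ-below xs n<l))
       (≅-trans (*-cong (≅-refl {x}) (≡⇒≅ (φ-below (x ∷ xs) (ℕₚ.m<n⇒m<1+n n<l)))) (zeroʳ x)))) ⟩
    scale (+ 1 / suc n) (φ xs n +P x *P φ (x ∷ xs) n) ∎
  where open import Relation.Binary.Reasoning.Setoid setoid

record Constant (p : Poly) : Set where
  constructor constant
  field C''≅0 : C'' p ≅ 0P
open Constant

constant-0 : Constant 0P
constant-0 = constant ≅-refl

constant-1 : Constant 1P
constant-1 = constant ≅-refl

constant-f : ∀ S → Constant (var (f S))
constant-f S = constant ≅-refl

constant-w : Constant (var w)
constant-w = constant ≅-refl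

constant-+ : ∀ {p q} → Constant p → Constant q → Constant (p +P q)
constant-+ {p} {q} cp cq = constant (≅-trans (C''-+ p q) (+-cong (C''≅0 cp) (C''≅0 cq)))

constant-* : ∀ {p q} → Constant p → Constant q → Constant (p *P q)
constant-* {p} {q} cp cq = constant (≅-trans (C''-* p q)
  (≅-trans (+-cong (*-cong (C''≅0 cp) (≅-refl {q})) (*-cong (≅-refl {p}) (C''≅0 cq))) (zeroʳ p)))

constant-scale : ∀ k {p} → Constant p → Constant (scale k p)
constant-scale k {p} cp = constant (≅-trans (C''-scale k p) (scale-cong k (C''≅0 cp)))

constant-sumP : ∀ (F : A → Poly) xs → (∀ x → Constant (F x)) → Constant (sumP (map F xs))
constant-sumP F [] cF = constant-0
constant-sumP F (x ∷ xs) cF = constant-+ (cF x) (constant-sumP F xs cF)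

constant-prodP : ∀ (F : A → Poly) xs → (∀ x → Constant (F x)) → Constant (prodP (map F xs))
constant-prodP F [] cF = constant-1
constant-prodP F (x ∷ xs) cF = constant-* (cF x) (constant-prodP F xs cF)

constant-h : ∀ j xs → All Constant xs → Constant (h j xs)
constant-h zero [] _ = constant-1
constant-h (suc j) [] _ = constant-0
constant-h j (x ∷ xs) (cx ∷ cxs) = subst Constant (sym (h-cons x xs j))
  (constant-sumP _ (upTo (suc j)) λ a →
     constant-* (constant-prodP (λ _ → x) (upTo a) (λ _ → cx)) (constant-h (j ∸ a) xs cxs))

constant-φ : ∀ xs n → All Constant xs → Constant (φ xs n)
constant-φ [] zero _ = constant-1
constant-φ [] (suc n) _ = constant-0
constant-φ (x ∷ xs) n cxs with suc (length xs) ≤ᵇ n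
... | true = constant-scale (invFact n) (constant-h (n ∸ suc (length xs)) (x ∷ xs) cxs)
... | false = constant-0

constant-symVal : ∀ s → Constant (symVal s)
constant-symVal ● = constant-* constant-w (constant-f _)
constant-symVal ○ = constant-f _

constant-φW : ∀ S n → Constant (φW S n)
constant-φW S n = constant-φ (map symVal S) n (All.map⁺ (All.universal constant-symVal S))

constant-wpow : ∀ n → Constant (wpow n)
constant-wpow zero = constant-1
constant-wpow (suc n) = constant-* constant-w (constant-wpow n)

constant-Ω : ∀ η → Constant (Ω η)
constant-Ω [] = constant-1
constant-Ω (p ∷ []) = constant-1
constant-Ω (p ∷ q ∷ η) = constant-* (constant-f _) (constant-Ω (q ∷ η))

C''-constant-* : ∀ {p} q → Constant p → C'' (p *P q) ≅ p *P C'' q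
C''-constant-* {p} q cp = ≅-trans (C''-* p q)
  (≅-trans (+-cong (*-cong (C''≅0 cp) (≅-refl {q})) (≅-refl {p *P C'' q})) ≅-refl)

C''-*-constant : ∀ p {q} → Constant q → C'' (p *P q) ≅ C'' p *P q
C''-*-constant p {q} cq = ≅-trans (C''-* p q)
  (≅-trans (+-cong (≅-refl {C'' p *P q}) (≅-trans (*-cong (≅-refl {p}) (C''≅0 cq)) (zeroʳ p))) (+-identityʳ _))

C''-g : ∀ r rest → C'' (var (g (r ∷ rest))) ≅ Cg r rest
C''-g r rest = ≅-trans (+-identityʳ _) (≅-trans (scale-one _)
  (≅-trans (+-cong (*-identityʳ (Cg r rest)) (zeroʳ (mono [ g (r ∷ rest) ]))) (+-identityʳ _)))
  where
  scale-one : ∀ p → scale 1ℚ p ≅ p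
  scale-one p = coeff↭-≅ λ m → trans (coeff↭-scale 1ℚ p m) (ℚₚ.*-identityˡ _)

compositions : ℕ → Word → List (List Part)
compositions M R = concatMap (λ k → comps (suc k) R) (upTo M)

sumComps : ℕ → Word → (List Part → Poly) → Poly
sumComps M R G = sumP (map G (compositions M R))

sumComps-by-size : ∀ M R G → sumComps M R G ≅ sumP (map (λ k → sumP (map G (comps (suc k) R))) (upTo M))
sumComps-by-size M R G = sumP-concatMap G (λ k → comps (suc k) R) (upTo M)

prependPart : Sym → Part → Part
prependPart y (x , xs) = (y , x ∷ xs)

onSplit : (Part → Poly) → (Part → Word → Poly) → Part × Word → Poly
onSplit whole cut (p , []) = whole p
onSplit whole cut (p , r ∷ rs) = cut p (r ∷ rs)

sumP-nsplits : ∀ whole cut y ys →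
  sumP (map (onSplit whole cut) (nsplits (y ∷ ys))) ≅
  whole (y , ys) +P sumP (map (λ { (a , x , b) → cut (y , a) (x ∷ b) }) (picks ys))
sumP-nsplits whole cut y [] = ≅-refl
sumP-nsplits whole cut y (z ∷ zs) = begin
    cut (y , []) (z ∷ zs)
      +P sumP (map (onSplit whole cut) (map (λ t → (prependPart y (proj₁ t) , proj₂ t)) (nsplits (z ∷ zs))))
  ≡⟨ cong (λ s → cut (y , []) (z ∷ zs) +P s)
       (trans (sumP-map _ _ (nsplits (z ∷ zs))) (cong sumP (List.map-cong onSplit-prepend (nsplits (z ∷ zs))))) ⟩
    cut (y , []) (z ∷ zs) +P sumP (map (onSplit (whole ∘ prependPart y) (cut ∘ prependPart y)) (nsplits (z ∷ zs)))
  ≈⟨ +-cong (≅-refl {cut (y , []) (z ∷ zs)}) (sumP-nsplits (whole ∘ prependPart y) (cut ∘ prependPart y) z zs) ⟩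
    cut (y , []) (z ∷ zs) +P (whole (y , z ∷ zs) +P Σcuts)
  ≈⟨ solve-ℙ 3 (λ c w s → c ⊕ (w ⊕ s) ≐ w ⊕ (c ⊕ s)) ≅-refl (cut (y , []) (z ∷ zs)) (whole (y , z ∷ zs)) Σcuts ⟩
    whole (y , z ∷ zs) +P (cut (y , []) (z ∷ zs) +P Σcuts)
  ≡⟨ cong (λ s → whole (y , z ∷ zs) +P (cut (y , []) (z ∷ zs) +P s)) (sym (sumP-map _ _ (picks zs))) ⟩
    whole (y , z ∷ zs) +P sumP (map (λ { (a , x , b) → cut (y , a) (x ∷ b) }) (picks (z ∷ zs))) ∎
  where
  open import Relation.Binary.Reasoning.Setoid setoid
  Σcuts = sumP (map (λ { (a , x , b) → cut (y , z ∷ a) (x ∷ b) }) (picks zs))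
  onSplit-prepend : ∀ t → onSplit whole cut (prependPart y (proj₁ t) , proj₂ t)
                        ≡ onSplit (whole ∘ prependPart y) (cut ∘ prependPart y) t
  onSplit-prepend (p , []) = refl
  onSplit-prepend (p , _ ∷ _) = refl

sumComps-first-part : ∀ M y ys G →
  sumComps (suc M) (y ∷ ys) G ≅
  G [ (y , ys) ] +P sumP (map (λ { (a , x , b) → sumComps M (x ∷ b) (λ η → G ((y , a) ∷ η)) }) (picks ys))
sumComps-first-part M y ys G = begin
    sumComps (suc M) R G
  ≈⟨ sumComps-by-size (suc M) R G ⟩
    sumP (map (λ k → sumP (map G (comps (suc k) R))) (upTo (suc M)))
  ≈⟨ sumP-cong (upTo (suc M)) (λ k → ≅-trans
       (sumP-concatMap G (λ t → map (proj₁ t ∷_) (comps k (proj₂ t))) (nsplits R))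
       (sumP-cong (nsplits R) (λ t → ≡⇒≅ (sumP-map G (proj₁ t ∷_) (comps k (proj₂ t)))))) ⟩
    sumP (map (λ k → sumP (map (λ t → restSum k t) (nsplits R))) (upTo (suc M)))
  ≈⟨ sumP-comm restSum (upTo (suc M)) (nsplits R) ⟩
    sumP (map (λ t → sumP (map (λ k → restSum k t) (upTo (suc M)))) (nsplits R))
  ≈⟨ sumP-cong (nsplits R) by-rest ⟩
    sumP (map (onSplit (λ p → G [ p ]) (λ p rest → sumComps M rest (G ∘ (p ∷_)))) (nsplits R))
  ≈⟨ sumP-nsplits _ _ y ys ⟩
    G [ (y , ys) ] +P sumP (map (λ { (a , x , b) → sumComps M (x ∷ b) (λ η → G ((y , a) ∷ η)) }) (picks ys)) ∎
  where
  open import Relation.Binary.Reasoning.Setoid setoid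
  R = y ∷ ys
  restSum : ℕ → Part × Word → Poly
  restSum k (p , rest) = sumP (map (G ∘ (p ∷_)) (comps k rest))
  by-rest : ∀ t → sumP (map (λ k → restSum k t) (upTo (suc M)))
                ≅ onSplit (λ p → G [ p ]) (λ p rest → sumComps M rest (G ∘ (p ∷_))) t
  by-rest (p , []) = begin
      sumP (map (λ k → restSum k (p , [])) (upTo (suc M)))
    ≡⟨ sumP-upTo-suc (λ k → restSum k (p , [])) M ⟩
      (G [ p ] +P 0P) +P sumP (map (λ _ → 0P) (upTo M))
    ≡⟨ cong ((G [ p ] +P 0P) +P_) (sumP-zero (upTo M)) ⟩
      (G [ p ] +P 0P) +P 0P
    ≈⟨ ≅-trans (+-identityʳ _) (+-identityʳ _) ⟩
      G [ p ] ∎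
  by-rest (p , r ∷ rs) = begin
      sumP (map (λ k → restSum k (p , r ∷ rs)) (upTo (suc M)))
    ≡⟨ sumP-upTo-suc (λ k → restSum k (p , r ∷ rs)) M ⟩
      0P +P sumP (map (λ k → restSum (suc k) (p , r ∷ rs)) (upTo M))
    ≈⟨ ≅-sym (sumComps-by-size M (r ∷ rs) (G ∘ (p ∷_))) ⟩
      sumComps M (r ∷ rs) (G ∘ (p ∷_)) ∎

data StartsWith (r : Sym) : List Part → Set where
  starts : ∀ rest η → StartsWith r ((r , rest) ∷ η)

nsplits-head : ∀ r rs → All (λ t → proj₁ (proj₁ t) ≡ r) (nsplits (r ∷ rs))
nsplits-head r rs = refl ∷ All.map⁺ (All.universal (λ _ → refl) (nsplits rs))

compositions-start : ∀ M r rs → All (StartsWith r) (compositions M (r ∷ rs))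
compositions-start M r rs = All.concat⁺ (All.map⁺ (All.universal comps-start (upTo M)))
  where
  starts-with : ∀ {t} → proj₁ (proj₁ t) ≡ r → ∀ η → StartsWith r (proj₁ t ∷ η)
  starts-with {(_ , rest) , _} refl η = starts rest η
  comps-start : ∀ k → All (StartsWith r) (comps (suc k) (r ∷ rs))
  comps-start k = All.concat⁺ (All.map⁺ (All.map (λ {t} head≡r →
    All.map⁺ (All.universal (starts-with {t} head≡r) (comps k (proj₂ t)))) (nsplits-head r rs)))

sumComps-factor : ∀ M r rs {F G : List Part → Poly} c →
  (∀ rest η → F ((r , rest) ∷ η) ≅ c *P G ((r , rest) ∷ η)) →
  sumComps M (r ∷ rs) F ≅ c *P sumComps M (r ∷ rs) G
sumComps-factor M r rs {G = G} c F≅cG =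
  ≅-trans (sumP-congᴬ (All.map (λ { (starts rest η) → F≅cG rest η }) (compositions-start M r rs)))
          (≅-sym (sumP-*ˡ c G (compositions M (r ∷ rs))))

picks-suffix-length : ∀ ys → All (λ { (a , x , b) → length (x ∷ b) ℕ.≤ length ys }) (picks ys)
picks-suffix-length [] = []
picks-suffix-length (y ∷ ys) = ℕₚ.≤-refl ∷ All.map⁺ (All.map ℕₚ.m≤n⇒m≤1+n (picks-suffix-length ys))

-- The summand of ζ_{1,k} + ζ_{2,k} for a composition with ι = i, Ω = ω,
-- last part L and φ-index F = η_{k,1} ⋯ η_{1,1} S.
ζterm′ : ℕ → Poly → Word → Word → Series
ζterm′ i ω L F n = wpow i *P var (g (● ∷ L)) *P ω *P φW F n
                +P wpow (suc i) *P var (g (● ∷ [])) *P var (f (● ∷ L)) *P ω *P φW (● ∷ F) n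

-- Cg ● (x₁ ∷ tl) is definitionally
-- (cutTerm ([] , x₁ , tl) +P innerCuts x₁ tl) +P closingTerm (x₁ ∷ tl).
cutTerm : Word × Sym × Word → Poly
cutTerm (a , x , b) = wδ x *P var (g (● ∷ x ∷ b)) *P var (f (a ++ x ∷ []))

innerCuts : Sym → Word → Poly
innerCuts x₁ tl = sumP (map cutTerm (map (λ t → (x₁ ∷ proj₁ t , proj₂ t)) (picks tl)))

closingTerm : Word → Poly
closingTerm L = var w *P var (g (● ∷ [])) *P var (f (● ∷ L))

-- Differentiating φ_{x₁D} drops x₁ (dropTerm′); the remaining terms
-- (sharedTerm′) also occur in C'' of the summand, whose other terms cut the
-- last part in its interior (splitTerm′).
dropTerm′ : ℕ → Poly → Word → Word → Series
dropTerm′ i ω L D n = wpow i *P var (g (● ∷ L)) *P ω *P φW D n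

splitTerm′ : ℕ → Poly → Sym → Word → Word → Series
splitTerm′ i ω x₁ tl F n = wpow i *P ω *P φW F n *P innerCuts x₁ tl

sharedTerm′ : ℕ → Poly → Sym → Word → Word → Series
sharedTerm′ i ω x₁ tl F n =
  (wpow i *P ω *P φW F n) *P (cutTerm ([] , x₁ , tl) +P closingTerm (x₁ ∷ tl))
  +P (wpow (suc i) *P var (f (● ∷ x₁ ∷ tl)) *P ω *P φW (● ∷ F) n) *P closingTerm []

ζterm′-zero : ∀ i ω L x₁ D → ζterm′ i ω L (x₁ ∷ D) 0 ≅ 0P
ζterm′-zero i ω L x₁ D =
  +-cong (zeroʳ (wpow i *P var (g (● ∷ L)) *P ω)) (zeroʳ (wpow (suc i) *P var (g (● ∷ [])) *P var (f (● ∷ L)) *P ω))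

symVal≅wδ-* : ∀ s → symVal s ≅ wδ s *P var (f (s ∷ []))
symVal≅wδ-* ● = ≅-refl
symVal≅wδ-* ○ = ≅-sym (*-identityˡ _)

ζterm′-suc : ∀ i ω x₁ tl D n →
  ζterm′ i ω (x₁ ∷ tl) (x₁ ∷ D) (suc n) ≅
  scale (+ 1 / suc n) (dropTerm′ i ω (x₁ ∷ tl) D n +P sharedTerm′ i ω x₁ tl (x₁ ∷ D) n)
ζterm′-suc i ω x₁ tl D n = begin
    ζterm′ i ω (x₁ ∷ tl) (x₁ ∷ D) (suc n)
  ≈⟨ +-cong (*-cong (≅-refl {a *P gL *P ω}) (≅-trans (φ-suc (symVal x₁) (map symVal D) n)
              (≅-trans (scale≅constP-* c _) (*-cong (≅-refl {constP c})
                 (+-cong (≅-refl {φD}) (*-cong (symVal≅wδ-* x₁) (≅-refl {φF})))))))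
            (*-cong (≅-refl {var w *P a *P gb *P fbL *P ω})
              (≅-trans (φ-suc (symVal ●) (map symVal (x₁ ∷ D)) n) (scale≅constP-* c _))) ⟩
    (a *P gL *P ω) *P (constP c *P (φD +P (wδ x₁ *P fx) *P φF))
      +P (var w *P a *P gb *P fbL *P ω) *P (constP c *P (φF +P (var w *P fb) *P φbF))
  ≈⟨ solve-ℙ 13 (λ c a w gL ω φD φF φbF wx fx gb fbL fb →
        (a ⊗ gL ⊗ ω) ⊗ (c ⊗ (φD ⊕ (wx ⊗ fx) ⊗ φF)) ⊕ (w ⊗ a ⊗ gb ⊗ fbL ⊗ ω) ⊗ (c ⊗ (φF ⊕ (w ⊗ fb) ⊗ φbF))
        ≐ c ⊗ (a ⊗ gL ⊗ ω ⊗ φD ⊕ ((a ⊗ ω ⊗ φF) ⊗ (wx ⊗ gL ⊗ fx ⊕ w ⊗ gb ⊗ fbL)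
                                ⊕ (w ⊗ a ⊗ fbL ⊗ ω ⊗ φbF) ⊗ (w ⊗ gb ⊗ fb))))
      ≅-refl (constP c) a (var w) gL ω φD φF φbF (wδ x₁) fx gb fbL fb ⟩
    constP c *P (dropTerm′ i ω (x₁ ∷ tl) D n +P sharedTerm′ i ω x₁ tl (x₁ ∷ D) n)
  ≈⟨ ≅-sym (scale≅constP-* c _) ⟩
    scale c (dropTerm′ i ω (x₁ ∷ tl) D n +P sharedTerm′ i ω x₁ tl (x₁ ∷ D) n) ∎
  where
  open import Relation.Binary.Reasoning.Setoid setoid
  c = + 1 / suc n
  a = wpow i
  gL = var (g (● ∷ x₁ ∷ tl))
  gb = var (g (● ∷ []))
  fbL = var (f (● ∷ x₁ ∷ tl))
  fb = var (f (● ∷ []))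
  fx = var (f (x₁ ∷ []))
  φD = φW D n
  φF = φW (x₁ ∷ D) n
  φbF = φW (● ∷ x₁ ∷ D) n

C''-ζterm′ : ∀ i {ω} → Constant ω → ∀ x₁ tl F n →
  C'' (ζterm′ i ω (x₁ ∷ tl) F n) ≅ splitTerm′ i ω x₁ tl F n +P sharedTerm′ i ω x₁ tl F n
C''-ζterm′ i {ω} cω x₁ tl F n = begin
    C'' (T₁ +P T₂)
  ≈⟨ C''-+ T₁ T₂ ⟩
    C'' T₁ +P C'' T₂
  ≈⟨ +-cong C''T₁ C''T₂ ⟩
    a *P ((cut₀ +P innerCuts x₁ tl) +P closingTerm (x₁ ∷ tl)) *P ω *P φF
      +P wa *P closingTerm [] *P fbL *P ω *P φbF
  ≈⟨ solve-ℙ 10 (λ a ω φF φbF cut₀ inner close wa fbL close₀ →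
        a ⊗ ((cut₀ ⊕ inner) ⊕ close) ⊗ ω ⊗ φF ⊕ wa ⊗ close₀ ⊗ fbL ⊗ ω ⊗ φbF
        ≐ a ⊗ ω ⊗ φF ⊗ inner ⊕ ((a ⊗ ω ⊗ φF) ⊗ (cut₀ ⊕ close) ⊕ (wa ⊗ fbL ⊗ ω ⊗ φbF) ⊗ close₀))
      ≅-refl a ω φF φbF cut₀ (innerCuts x₁ tl) (closingTerm (x₁ ∷ tl)) wa fbL (closingTerm []) ⟩
    splitTerm′ i ω x₁ tl F n +P sharedTerm′ i ω x₁ tl F n ∎
  where
  open import Relation.Binary.Reasoning.Setoid setoid
  a = wpow i
  wa = wpow (suc i)
  gL = var (g (● ∷ x₁ ∷ tl))
  gb = var (g (● ∷ []))
  fbL = var (f (● ∷ x₁ ∷ tl))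
  φF = φW F n
  φbF = φW (● ∷ F) n
  cut₀ = cutTerm ([] , x₁ , tl)
  T₁ = a *P gL *P ω *P φF
  T₂ = wa *P gb *P fbL *P ω *P φbF
  C''T₁ : C'' T₁ ≅ a *P ((cut₀ +P innerCuts x₁ tl) +P closingTerm (x₁ ∷ tl)) *P ω *P φF
  C''T₁ = ≅-trans (C''-*-constant (a *P gL *P ω) (constant-φW F n))
    (*-cong (≅-trans (C''-*-constant (a *P gL) cω)
      (*-cong (≅-trans (C''-constant-* gL (constant-wpow i)) (*-cong (≅-refl {a}) (C''-g ● (x₁ ∷ tl))))
              (≅-refl {ω}))) (≅-refl {φF}))
  C''T₂ : C'' T₂ ≅ wa *P closingTerm [] *P fbL *P ω *P φbF
  C''T₂ = ≅-trans (C''-*-constant (wa *P gb *P fbL *P ω) (constant-φW (● ∷ F) n))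
    (*-cong (≅-trans (C''-*-constant (wa *P gb *P fbL) cω)
      (*-cong (≅-trans (C''-*-constant (wa *P gb) (constant-f (● ∷ x₁ ∷ tl)))
        (*-cong (≅-trans (C''-constant-* gb (constant-wpow (suc i))) (*-cong (≅-refl {wa}) (C''-g ● [])))
                (≅-refl {fbL}))) (≅-refl {ω}))) (≅-refl {φbF}))

lastPart : Part → List Part → Part
lastPart p [] = p
lastPart p (q ∷ η) = lastPart q η

-- η_{k-1,1} ⋯ η_{1,1} S for the composition p ∷ η
initFirsts : Part → List Part → Word → Word
initFirsts p [] S = S
initFirsts p (q ∷ η) S = initFirsts q η (proj₁ p ∷ S)

lastW≡lastPart : ∀ p η → lastW (p ∷ η) ≡ pw (lastPart p η)
lastW≡lastPart p [] = refl
lastW≡lastPart p (q ∷ η) = lastW≡lastPart q η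

firsts≡lastPart∷initFirsts : ∀ p η S → firsts (p ∷ η) ++ S ≡ proj₁ (lastPart p η) ∷ initFirsts p η S
firsts≡lastPart∷initFirsts p [] S = refl
firsts≡lastPart∷initFirsts p (q ∷ η) S = begin
    reverse (proj₁ p ∷ map proj₁ (q ∷ η)) ++ S
  ≡⟨ cong (_++ S) (List.unfold-reverse (proj₁ p) (map proj₁ (q ∷ η))) ⟩
    (firsts (q ∷ η) ++ [ proj₁ p ]) ++ S
  ≡⟨ List.++-assoc (firsts (q ∷ η)) [ proj₁ p ] S ⟩
    firsts (q ∷ η) ++ proj₁ p ∷ S
  ≡⟨ firsts≡lastPart∷initFirsts q η (proj₁ p ∷ S) ⟩
    proj₁ (lastPart q η) ∷ initFirsts q η (proj₁ p ∷ S) ∎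
  where open ≡-Reasoning

ζterm : Word → ℕ → List Part → Poly
ζterm S n η = ζterm′ (ι η) (Ω η) (lastW η) (firsts η ++ S) n

dropTerm splitTerm sharedTerm : Word → ℕ → List Part → Poly
dropTerm S n [] = 0P
dropTerm S n η@(p ∷ η′) = dropTerm′ (ι η) (Ω η) (pw (lastPart p η′)) (initFirsts p η′ S) n
splitTerm S n [] = 0P
splitTerm S n η@(p ∷ η′) = splitTerm′ (ι η) (Ω η) x₁ tl (x₁ ∷ initFirsts p η′ S) n
  where x₁ = proj₁ (lastPart p η′) ; tl = proj₂ (lastPart p η′)
sharedTerm S n [] = 0P
sharedTerm S n η@(p ∷ η′) = sharedTerm′ (ι η) (Ω η) x₁ tl (x₁ ∷ initFirsts p η′ S) n
  where x₁ = proj₁ (lastPart p η′) ; tl = proj₂ (lastPart p η′)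

module _ (S : Word) (p : Part) (η′ : List Part) where
  private
    η = p ∷ η′
    x₁ = proj₁ (lastPart p η′)
    tl = proj₂ (lastPart p η′)

  ζterm≡ζterm′ : ∀ n → ζterm S n η ≡ ζterm′ (ι η) (Ω η) (x₁ ∷ tl) (x₁ ∷ initFirsts p η′ S) n
  ζterm≡ζterm′ n = cong₂ (λ L F → ζterm′ (ι η) (Ω η) L F n) (lastW≡lastPart p η′) (firsts≡lastPart∷initFirsts p η′ S)

  ζterm-zero : ζterm S 0 η ≅ 0P
  ζterm-zero = ≅-trans (≡⇒≅ (ζterm≡ζterm′ 0)) (ζterm′-zero (ι η) (Ω η) (x₁ ∷ tl) x₁ (initFirsts p η′ S))

  ζterm-suc : ∀ n → ζterm S (suc n) η ≅ scale (+ 1 / suc n) (dropTerm S n η +P sharedTerm S n η)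
  ζterm-suc n = ≅-trans (≡⇒≅ (ζterm≡ζterm′ (suc n))) (ζterm′-suc (ι η) (Ω η) x₁ tl (initFirsts p η′ S) n)

  C''-ζterm : ∀ n → C'' (ζterm S n η) ≅ splitTerm S n η +P sharedTerm S n η
  C''-ζterm n = ≅-trans (≡⇒≅ (cong C'' (ζterm≡ζterm′ n)))
    (C''-ζterm′ (ι η) (constant-Ω η) x₁ tl (x₁ ∷ initFirsts p η′ S) n)

-- The telescoping identity

junction : Part → Sym → Poly
junction p r = wδ r *P var (f (pw p ++ r ∷ []))

wpow-ι-cons : ∀ p r rest η → wpow (ι (p ∷ (r , rest) ∷ η)) ≅ wδ r *P wpow (ι ((r , rest) ∷ η))
wpow-ι-cons p ● rest η = ≅-refl
wpow-ι-cons p ○ rest η = ≅-sym (*-identityˡ _)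

module _ (S : Word) (n : ℕ) (p : Part) (r : Sym) (rest : Word) (η : List Part) where
  private
    q = (r , rest)
    a = wpow (ι (q ∷ η))
    fp = var (f (pw p ++ r ∷ []))

  dropTerm-cons : dropTerm S n (p ∷ q ∷ η) ≅ junction p r *P dropTerm (proj₁ p ∷ S) n (q ∷ η)
  dropTerm-cons = ≅-trans
    (*-cong (*-cong (*-cong (wpow-ι-cons p r rest η) (≅-refl {gL})) (≅-refl {fp *P Ω (q ∷ η)})) (≅-refl {φD}))
    (solve-ℙ 6 (λ wr a gL fp ω φ → ((wr ⊗ a) ⊗ gL) ⊗ (fp ⊗ ω) ⊗ φ ≐ (wr ⊗ fp) ⊗ (a ⊗ gL ⊗ ω ⊗ φ))
       ≅-refl (wδ r) a gL fp (Ω (q ∷ η)) φD)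
    where
    gL = var (g (● ∷ pw (lastPart q η)))
    φD = φW (initFirsts q η (proj₁ p ∷ S)) n

  splitTerm-cons : splitTerm S n (p ∷ q ∷ η) ≅ junction p r *P splitTerm (proj₁ p ∷ S) n (q ∷ η)
  splitTerm-cons = ≅-trans
    (*-cong (*-cong (*-cong (wpow-ι-cons p r rest η) (≅-refl {fp *P Ω (q ∷ η)})) (≅-refl {φF})) (≅-refl {cuts}))
    (solve-ℙ 6 (λ wr a fp ω φ cuts → ((wr ⊗ a) ⊗ (fp ⊗ ω)) ⊗ φ ⊗ cuts ≐ (wr ⊗ fp) ⊗ (a ⊗ ω ⊗ φ ⊗ cuts))
       ≅-refl (wδ r) a fp (Ω (q ∷ η)) φF cuts)
    where
    x₁ = proj₁ (lastPart q η)
    φF = φW (x₁ ∷ initFirsts q η (proj₁ p ∷ S)) n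
    cuts = innerCuts x₁ (proj₂ (lastPart q η))

dropTerm-single : ∀ S n y ys → dropTerm S n [ (y , ys) ] ≅ var (g (● ∷ y ∷ ys)) *P φW S n
dropTerm-single S n y ys = *-cong (≅-trans (*-identityʳ _) (*-identityˡ (var (g (● ∷ y ∷ ys))))) (≅-refl {φW S n})

-- The left-hand side collects the terms of C''(g_{•R}) · φ_{R₁S} that cut R
-- in its interior.
interiorCuts≅splitTerm : ∀ S n y ys →
  sumP (map (λ { (a , x , b) → junction (y , a) x *P (var (g (● ∷ x ∷ b)) *P φW (y ∷ S) n) }) (picks ys))
  ≅ splitTerm S n [ (y , ys) ]
interiorCuts≅splitTerm S n y ys = begin
    sumP (map (λ { (a , x , b) → junction (y , a) x *P (var (g (● ∷ x ∷ b)) *P φyS) }) (picks ys))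
  ≈⟨ sumP-cong (picks ys) (λ { (a , x , b) →
       solve-ℙ 4 (λ wx fx gx φyS → (wx ⊗ fx) ⊗ (gx ⊗ φyS) ≐ φyS ⊗ ((wx ⊗ gx) ⊗ fx)) ≅-refl
         (wδ x) (var (f (y ∷ a ++ x ∷ []))) (var (g (● ∷ x ∷ b))) φyS }) ⟩
    sumP (map (λ t → φyS *P cutTerm (y ∷ proj₁ t , proj₂ t)) (picks ys))
  ≈⟨ ≅-sym (sumP-*ˡ φyS (λ t → cutTerm (y ∷ proj₁ t , proj₂ t)) (picks ys)) ⟩
    φyS *P sumP (map (λ t → cutTerm (y ∷ proj₁ t , proj₂ t)) (picks ys))
  ≈⟨ *-cong (≅-sym (≅-trans (*-cong (*-identityʳ 1P) (≅-refl {φyS})) (*-identityˡ φyS)))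
            (≡⇒≅ (sym (sumP-map cutTerm _ (picks ys)))) ⟩
    splitTerm S n [ (y , ys) ] ∎
  where
  open import Relation.Binary.Reasoning.Setoid setoid
  φyS = φW (y ∷ S) n

-- Peeling off the first part (y , a) of a composition of y a x b factors its
-- drop and split terms by junction (y , a) x, and the leftover drop term
-- g_{•xb} φ_{yS} of the tail is an interior cut of y a x b.
sumComps-dropTerm : ∀ M y ys S n → length (y ∷ ys) ℕ.≤ M →
  sumComps M (y ∷ ys) (dropTerm S n) ≅ var (g (● ∷ y ∷ ys)) *P φW S n +P sumComps M (y ∷ ys) (splitTerm S n)
sumComps-dropTerm (suc M) y ys S n (ℕ.s≤s |ys|≤M) = begin
    sumComps (suc M) (y ∷ ys) (dropTerm S n)
  ≈⟨ sumComps-first-part M y ys (dropTerm S n) ⟩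
    dropTerm S n [ (y , ys) ] +P sumP (map (λ { (a , x , b) → sumComps M (x ∷ b) (dropTerm S n ∘ ((y , a) ∷_)) }) (picks ys))
  ≈⟨ +-cong (dropTerm-single S n y ys)
            (≅-trans (sumP-congᴬ (All.map (λ { {a , x , b} → by-first-part a x b }) (picks-suffix-length ys)))
                     (sumP-+ _ _ (picks ys))) ⟩
    gφ +P (sumP (map (λ { (a , x , b) → junction (y , a) x *P (var (g (● ∷ x ∷ b)) *P φW (y ∷ S) n) }) (picks ys))
           +P sumP (map (λ { (a , x , b) → sumComps M (x ∷ b) (splitTerm S n ∘ ((y , a) ∷_)) }) (picks ys)))
  ≈⟨ +-cong (≅-refl {gφ}) (+-cong (interiorCuts≅splitTerm S n y ys) ≅-refl) ⟩
    gφ +P (splitTerm S n [ (y , ys) ]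
           +P sumP (map (λ { (a , x , b) → sumComps M (x ∷ b) (splitTerm S n ∘ ((y , a) ∷_)) }) (picks ys)))
  ≈⟨ +-cong (≅-refl {gφ}) (≅-sym (sumComps-first-part M y ys (splitTerm S n))) ⟩
    gφ +P sumComps (suc M) (y ∷ ys) (splitTerm S n) ∎
  where
  open import Relation.Binary.Reasoning.Setoid setoid
  gφ = var (g (● ∷ y ∷ ys)) *P φW S n
  by-first-part : ∀ a x b → length (x ∷ b) ℕ.≤ length ys →
    sumComps M (x ∷ b) (dropTerm S n ∘ ((y , a) ∷_)) ≅
    junction (y , a) x *P (var (g (● ∷ x ∷ b)) *P φW (y ∷ S) n) +P sumComps M (x ∷ b) (splitTerm S n ∘ ((y , a) ∷_))
  by-first-part a x b |xb|≤|ys| = begin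
      sumComps M (x ∷ b) (dropTerm S n ∘ ((y , a) ∷_))
    ≈⟨ sumComps-factor M x b (junction (y , a) x) (dropTerm-cons S n (y , a) x) ⟩
      junction (y , a) x *P sumComps M (x ∷ b) (dropTerm (y ∷ S) n)
    ≈⟨ *-cong (≅-refl {junction (y , a) x}) (sumComps-dropTerm M x b (y ∷ S) n (ℕₚ.≤-trans |xb|≤|ys| |ys|≤M)) ⟩
      junction (y , a) x *P (var (g (● ∷ x ∷ b)) *P φW (y ∷ S) n +P sumComps M (x ∷ b) (splitTerm (y ∷ S) n))
    ≈⟨ distribˡ (junction (y , a) x) _ _ ⟩
      junction (y , a) x *P (var (g (● ∷ x ∷ b)) *P φW (y ∷ S) n)
        +P junction (y , a) x *P sumComps M (x ∷ b) (splitTerm (y ∷ S) n)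
    ≈⟨ +-cong ≅-refl (≅-sym (sumComps-factor M x b (junction (y , a) x) (splitTerm-cons S n (y , a) x))) ⟩
      junction (y , a) x *P (var (g (● ∷ x ∷ b)) *P φW (y ∷ S) n) +P sumComps M (x ∷ b) (splitTerm S n ∘ ((y , a) ∷_)) ∎

-- ζ solves the defining equation of τ

ζsum≅sumComps : ∀ R S n → ζsum R S n ≅ sumComps (length R) R (ζterm S n)
ζsum≅sumComps R S n = ≅-trans
  (sumP-cong (upTo (length R)) (λ k → ≅-sym (sumP-+ ζ₁-term ζ₂-term (comps (suc k) R))))
  (≅-sym (sumComps-by-size (length R) R (ζterm S n)))
  where
  ζ₁-term ζ₂-term : List Part → Poly
  ζ₁-term η = wpow (ι η) *P var (g (● ∷ lastW η)) *P Ω η *P φW (firsts η ++ S) n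
  ζ₂-term η = wpow (suc (ι η)) *P var (g (● ∷ [])) *P var (f (● ∷ lastW η)) *P Ω η *P φW (● ∷ firsts η ++ S) n

module _ (y : Sym) (ys S : Word) where
  private
    R = y ∷ ys
    M = length R
    onCompositions : ∀ {F G : List Part → Poly} → (∀ rest η → F ((y , rest) ∷ η) ≅ G ((y , rest) ∷ η)) →
      sumComps M R F ≅ sumComps M R G
    onCompositions F≅G = sumP-congᴬ (All.map (λ { (starts rest η) → F≅G rest η }) (compositions-start M y ys))

  ζsum-zero : ζsum R S 0 ≅ 0P
  ζsum-zero = ≅-trans (ζsum≅sumComps R S 0)
    (≅-trans (onCompositions {G = λ _ → 0P} (λ rest η → ζterm-zero S (y , rest) η)) (≡⇒≅ (sumP-zero (compositions M R))))

  C''-ζsum : ∀ n → C'' (ζsum R S n) ≅ sumComps M R (splitTerm S n) +P sumComps M R (sharedTerm S n)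
  C''-ζsum n = ≅-trans (C''-cong (ζsum≅sumComps R S n)) (≅-trans (C''-sumP (ζterm S n) (compositions M R))
    (≅-trans (onCompositions {G = λ η → splitTerm S n η +P sharedTerm S n η} (λ rest η → C''-ζterm S (y , rest) η n))
      (sumP-+ (splitTerm S n) (sharedTerm S n) (compositions M R))))

  ζsum-suc : ∀ n → ζsum R S (suc n) ≅ scale (+ 1 / suc n) (C'' (ζsum R S n) +P var (g (● ∷ R)) *P φW S n)
  ζsum-suc n = begin
      ζsum R S (suc n)
    ≈⟨ ζsum≅sumComps R S (suc n) ⟩
      sumComps M R (ζterm S (suc n))
    ≈⟨ onCompositions {G = λ η → constP c *P (dropTerm S n η +P sharedTerm S n η)}
         (λ rest η → ≅-trans (ζterm-suc S (y , rest) η n) (scale≅constP-* c _)) ⟩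
      sumP (map (λ η → constP c *P (dropTerm S n η +P sharedTerm S n η)) (compositions M R))
    ≈⟨ ≅-trans (≅-sym (sumP-*ˡ (constP c) _ (compositions M R)))
               (*-cong (≅-refl {constP c}) (sumP-+ (dropTerm S n) (sharedTerm S n) (compositions M R))) ⟩
      constP c *P (sumComps M R (dropTerm S n) +P Σshared)
    ≈⟨ *-cong (≅-refl {constP c}) (+-cong (sumComps-dropTerm M y ys S n ℕₚ.≤-refl) (≅-refl {Σshared})) ⟩
      constP c *P ((gφ +P Σsplit) +P Σshared)
    ≈⟨ solve-ℙ 4 (λ c gφ split shared → c ⊗ ((gφ ⊕ split) ⊕ shared) ≐ c ⊗ ((split ⊕ shared) ⊕ gφ))
         ≅-refl (constP c) gφ Σsplit Σshared ⟩
      constP c *P ((Σsplit +P Σshared) +P gφ)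
    ≈⟨ *-cong (≅-refl {constP c}) (+-cong (≅-sym (C''-ζsum n)) (≅-refl {gφ})) ⟩
      constP c *P (C'' (ζsum R S n) +P gφ)
    ≈⟨ ≅-sym (scale≅constP-* c _) ⟩
      scale c (C'' (ζsum R S n) +P gφ) ∎
    where
    open import Relation.Binary.Reasoning.Setoid setoid
    c = + 1 / suc n
    gφ = var (g (● ∷ R)) *P φW S n
    Σsplit = sumComps M R (splitTerm S n)
    Σshared = sumComps M R (sharedTerm S n)

  τ≅ζsum : ∀ n → τ R S n ≅ ζsum R S n
  τ≅ζsum zero = ≅-sym ζsum-zero
  τ≅ζsum (suc n) = ≅-trans
    (scale-cong (+ 1 / suc n) (+-cong (C''-cong (τ≅ζsum n)) (≅-refl {var (g (● ∷ R)) *P φW S n})))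
    (≅-sym (ζsum-suc n))

τ-empty≅τε : ∀ S n → τ [] S n ≅ τε S n
τ-empty≅τε S zero = ≅-sym (zeroʳ (var (g (● ∷ []))))
τ-empty≅τε S (suc n) = begin
    scale c (C'' (τ [] S n) +P g● *P φW S n)
  ≈⟨ scale-cong c (+-cong (C''-cong (τ-empty≅τε S n)) (≅-refl {g● *P φW S n})) ⟩
    scale c (C'' (g● *P φ●S) +P g● *P φW S n)
  ≈⟨ ≅-trans (scale≅constP-* c _) (*-cong (≅-refl {constP c})
       (+-cong (≅-trans (C''-*-constant g● (constant-φW (● ∷ S) n)) (*-cong (C''-g ● []) (≅-refl {φ●S})))
               (≅-refl {g● *P φW S n}))) ⟩
    constP c *P (closingTerm [] *P φ●S +P g● *P φW S n)
  ≈⟨ solve-ℙ 6 (λ c w g● f● φ●S φS → c ⊗ ((w ⊗ g● ⊗ f●) ⊗ φ●S ⊕ g● ⊗ φS) ≐ g● ⊗ (c ⊗ (φS ⊕ (w ⊗ f●) ⊗ φ●S)))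
       ≅-refl (constP c) (var w) g● (var (f (● ∷ []))) φ●S (φW S n) ⟩
    g● *P (constP c *P (φW S n +P symVal ● *P φ●S))
  ≈⟨ *-cong (≅-refl {g●}) (≅-sym (≅-trans (φ-suc (symVal ●) (map symVal S) n) (scale≅constP-* c _))) ⟩
    g● *P φW (● ∷ S) (suc n) ∎
  where
  open import Relation.Binary.Reasoning.Setoid setoid
  c = + 1 / suc n
  g● = var (g (● ∷ []))
  φ●S = φW (● ∷ S) n

mainTheorem4 : ((R S : Word) → ¬ (R ≡ []) → τ R S ≈S ζsum R S)
               × ((S : Word) → τ [] S ≈S τε S)
mainTheorem4 = nonempty , (λ S n → ≅⇒≈P (τ-empty≅τε S n))
  where
  nonempty : (R S : Word) → ¬ (R ≡ []) → τ R S ≈S ζsum R S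
  nonempty [] S R≢[] = ⊥-elim (R≢[] refl)
  nonempty (y ∷ ys) S _ n = ≅⇒≈P (τ≅ζsum y ys S n)
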